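{- Let $n\geq 2$ and let $\Phi$ be either $K_n$ or $K_n^*$. Then $\Phi$ is determined by its $\mathcal{E}$-spectrum, i.e., every signed digraph whose Eisenstein matrix has the same spectrum as $\mathcal{E}(\Phi)$ is switching isomorphic to $\Phi$.
   Context: Let $\omega=e^{i\pi/3}$ and $\mathbb{T}_6=\{\omega^k: k=0,\dots,5\}$. A signed digraph $\Phi=(G,\varphi)$ consists of a finite simple graph $G$ and a map $\varphi$ assigning to every ordered pair $(u,v)$ of adjacent vertices a value $\varphi(u,v)\in\mathbb{T}_6$ with $\varphi(v,u)=\overline{\varphi(u,v)}$; its Eisenstein matrix $\mathcal{E}(\Phi)$ has $\mathcal{E}_{uv}=\varphi(u,v)$ for adjacent $u,v$ and $0$ otherwise. $K_n$ is the complete graph regarded as the signed digraph with all gains $1$; $K_n^*$ is obtained from $K_n$ by changing the gains of exactly one edge $\{u,v\}$ to $\varphi(u,v)=\omega$, $\varphi(v,u)=\overline\omega$. Two signed digraphs are switching isomorphic if one can be obtained from the other by a sequence of the operations: $\mathcal{E}\mapsto X\mathcal{E}X^{ -1}$ with $X$ diagonal with diagonal entries in $\mathbb{T}_6$; relabeling vertices; taking the converse ($\mathcal{E}\mapsto\mathcal{E}^\top$). -}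

module Defs where

open import Data.Nat using (ℕ; zero; suc)
open import Data.Integer as ℤ using (ℤ; +_; -[1+_])
open import Data.Fin using (Fin; zero; suc; punchIn; _≟_)
open import Data.Maybe using (Maybe; just; nothing; maybe)
import Data.Maybe as Maybe
open import Data.List using (List; []; _∷_; map)
open import Data.Product using (Σ; _,_)
open import Data.Bool using (if_then_else_)
open import Data.Empty using (⊥-elim)
open import Relation.Nullary using (does; yes; no)
open import Relation.Binary.PropositionalEquality using (_≡_; refl)
open import Relation.Binary.Construct.Closure.ReflexiveTransitive using (Star)
open import Function.Bundles using (_↔_; Inverse)

-- Eisenstein integers ℤ[ω], ω = e^{iπ/3}, ω² = ω - 1.
-- ew a b represents a + b ω.

record ℤω : Set where
  constructor ew
  field
    re : ℤ
    im : ℤ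

0ᵉ 1ᵉ : ℤω
0ᵉ = ew (+ 0) (+ 0)
1ᵉ = ew (+ 1) (+ 0)

infixl 6 _+ᵉ_
infixl 7 _*ᵉ_

_+ᵉ_ : ℤω → ℤω → ℤω
ew a b +ᵉ ew c d = ew (a ℤ.+ c) (b ℤ.+ d)

-ᵉ_ : ℤω → ℤω
-ᵉ ew a b = ew (ℤ.- a) (ℤ.- b)

-- (a + bω)(c + dω) = (ac - bd) + (ad + bc + bd) ω
_*ᵉ_ : ℤω → ℤω → ℤω
ew a b *ᵉ ew c d = ew (a ℤ.* c ℤ.- b ℤ.* d) (a ℤ.* d ℤ.+ b ℤ.* c ℤ.+ b ℤ.* d)

-- complex conjugation: conj ω = 1 - ω
conjᵉ : ℤω → ℤω
conjᵉ (ew a b) = ew (a ℤ.+ b) (ℤ.- b)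

-- The group 𝕋₆ = {ω^k : k = 0..5}, represented by exponents k : Fin 6.

T6 : Set
T6 = Fin 6

toℤω : T6 → ℤω
toℤω zero = ew (+ 1) (+ 0)
toℤω (suc zero) = ew (+ 0) (+ 1)
toℤω (suc (suc zero)) = ew -[1+ 0 ] (+ 1)                    -- ω² = ω - 1
toℤω (suc (suc (suc zero))) = ew -[1+ 0 ] (+ 0)              -- ω³ = -1
toℤω (suc (suc (suc (suc zero)))) = ew (+ 0) -[1+ 0 ]        -- ω⁴ = -ω
toℤω (suc (suc (suc (suc (suc zero))))) = ew (+ 1) -[1+ 0 ]  -- ω⁵ = 1 - ω

-- conjugate of ω^k is ω^{6-k}
conj6 : T6 → T6
conj6 zero = zero
conj6 (suc zero) = suc (suc (suc (suc (suc zero))))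
conj6 (suc (suc zero)) = suc (suc (suc (suc zero)))
conj6 (suc (suc (suc zero))) = suc (suc (suc zero))
conj6 (suc (suc (suc (suc zero)))) = suc (suc zero)
conj6 (suc (suc (suc (suc (suc zero))))) = suc zero

-- Signed digraphs on vertex set Fin n.
-- gain u v = nothing  : u, v not adjacent
-- gain u v = just g   : u, v adjacent with φ(u,v) = g
-- The underlying graph is simple (no loops; adjacency symmetric) and
-- φ(v,u) = conj φ(u,v).

record SignedDigraph (n : ℕ) : Set where
  field
    gain     : Fin n → Fin n → Maybe T6
    loopless : ∀ u → gain u u ≡ nothing
    herm     : ∀ u v → gain v u ≡ Maybe.map conj6 (gain u v)
open SignedDigraph public

Eis : ∀ {n} → SignedDigraph n → Fin n → Fin n → ℤω
Eis Φ u v = maybe toℤω 0ᵉ (gain Φ u v)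

-- K_n and K_n^* (the modified edge is {0,1}; n = 2 + k)

kgain : ∀ {n} → Fin n → Fin n → Maybe T6
kgain i j = if does (i ≟ j) then nothing else just zero

kgain-loop : ∀ {n} (u : Fin n) → kgain u u ≡ nothing
kgain-loop u with u ≟ u
... | yes _ = refl
... | no ¬p = ⊥-elim (¬p refl)

kgain-herm : ∀ {n} (u v : Fin n) → kgain v u ≡ Maybe.map conj6 (kgain u v)
kgain-herm u v with u ≟ v | v ≟ u
... | yes _ | yes _ = refl
... | no _  | no _  = refl
... | yes refl | no ¬p = ⊥-elim (¬p refl)
... | no ¬p | yes refl = ⊥-elim (¬p refl)

K : (n : ℕ) → SignedDigraph n
K n = record { gain = kgain ; loopless = kgain-loop ; herm = kgain-herm }

ksgain : ∀ {k} → Fin (suc (suc k)) → Fin (suc (suc k)) → Maybe T6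
ksgain zero (suc zero) = just (suc zero)
ksgain (suc zero) zero = just (suc (suc (suc (suc (suc zero)))))
ksgain i j = kgain i j

ksgain-loop : ∀ {k} (u : Fin (suc (suc k))) → ksgain u u ≡ nothing
ksgain-loop zero = refl
ksgain-loop (suc zero) = refl
ksgain-loop (suc (suc u)) = kgain-loop (suc (suc u))

ksgain-herm : ∀ {k} (u v : Fin (suc (suc k))) → ksgain v u ≡ Maybe.map conj6 (ksgain u v)
ksgain-herm zero zero = refl
ksgain-herm zero (suc zero) = refl
ksgain-herm zero (suc (suc v)) = kgain-herm zero (suc (suc v))
ksgain-herm (suc zero) zero = refl
ksgain-herm (suc zero) (suc zero) = refl
ksgain-herm (suc zero) (suc (suc v)) = kgain-herm (suc zero) (suc (suc v))
ksgain-herm (suc (suc u)) zero = kgain-herm (suc (suc u)) zero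
ksgain-herm (suc (suc u)) (suc zero) = kgain-herm (suc (suc u)) (suc zero)
ksgain-herm (suc (suc u)) (suc (suc v)) = kgain-herm (suc (suc u)) (suc (suc v))

Kstar : (k : ℕ) → SignedDigraph (suc (suc k))
Kstar k = record { gain = ksgain ; loopless = ksgain-loop ; herm = ksgain-herm }

-- Polynomials over ℤ[ω] (coefficient lists, lowest degree first),
-- compared coefficientwise (so trailing zeros are irrelevant).

Poly : Set
Poly = List ℤω

coeff : Poly → ℕ → ℤω
coeff [] _ = 0ᵉ
coeff (a ∷ p) zero = a
coeff (a ∷ p) (suc k) = coeff p k

_≈P_ : Poly → Poly → Set
p ≈P q = ∀ k → coeff p k ≡ coeff q k

addP : Poly → Poly → Poly
addP [] q = q
addP (a ∷ p) [] = a ∷ p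
addP (a ∷ p) (b ∷ q) = (a +ᵉ b) ∷ addP p q

negP : Poly → Poly
negP = map -ᵉ_

mulP : Poly → Poly → Poly
mulP [] q = []
mulP (a ∷ p) q = addP (map (a *ᵉ_) q) (0ᵉ ∷ mulP p q)

altSum : ∀ {k} → (Fin k → Poly) → Poly
altSum {zero} f = []
altSum {suc k} f = addP (f zero) (negP (altSum (λ j → f (suc j))))

det : ∀ n → (Fin n → Fin n → Poly) → Poly
det zero M = 1ᵉ ∷ []
det (suc n) M = altSum (λ j → mulP (M zero j) (det n (λ r c → M (suc r) (punchIn j c))))

charPoly : ∀ {n} → (Fin n → Fin n → ℤω) → Poly
charPoly {n} A = det n (λ i j →
  if does (i ≟ j) then (-ᵉ A i j) ∷ 1ᵉ ∷ [] else (-ᵉ A i j) ∷ [])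

-- Two Hermitian matrices have the same spectrum iff same characteristic polynomial.
Cospectral : ∀ {m n} → SignedDigraph m → SignedDigraph n → Set
Cospectral Ψ Φ = charPoly (Eis Ψ) ≈P charPoly (Eis Φ)

SD : Set
SD = Σ ℕ SignedDigraph

data Step : SD → SD → Set where
  -- E ↦ X E X⁻¹, X = diag(ω^{x u}); note X⁻¹ = conj X
  switch : ∀ {n} {Φ Φ' : SignedDigraph n} (x : Fin n → T6) →
    (∀ u v → Eis Φ' u v ≡ toℤω (x u) *ᵉ Eis Φ u v *ᵉ conjᵉ (toℤω (x v))) →
    Step (n , Φ) (n , Φ')
  relabel : ∀ {m n} {Φ : SignedDigraph n} {Φ' : SignedDigraph m} (σ : Fin m ↔ Fin n) →
    (∀ u v → Eis Φ' u v ≡ Eis Φ (Inverse.to σ u) (Inverse.to σ v)) →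
    Step (n , Φ) (m , Φ')
  converse : ∀ {n} {Φ Φ' : SignedDigraph n} →
    (∀ u v → Eis Φ' u v ≡ Eis Φ v u) →
    Step (n , Φ) (n , Φ')

SwitchingIsomorphic : SD → SD → Set
SwitchingIsomorphic = Star Step

-- The coefficient of x^j in the characteristic polynomial of an n × n matrix A is the sum of
-- the principal (n − j)-minors of −A, so cospectral signed digraphs share these sums. For an
-- Eisenstein matrix a principal 2-minor is −1 or 0 according as the two vertices are adjacent,
-- and once all vertices are adjacent a principal 3-minor is defect t − 2, where t is the gain
-- around the triangle and defect t = |1 − ω^t|². Hence a digraph cospectral with K_n (resp. K_n^*)
-- is complete with total triangle defect 0 (resp. n − 2). Defect 0 means that every triangle is
-- balanced, and switching by the gains at one vertex yields K_n. By the cocycle identity for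
-- triangle gains, a positive total defect is at least n − 2; analysing the equality case while
-- deleting a vertex shows that the digraph switches to K_n^* after moving its special edge into
-- place by relabelling.

module Submission where

open import Defs
open import Algebra.Bundles using (AbelianGroup)
import Algebra.Properties.CommutativeSemigroup as CommutativeSemigroupProperties
open import Data.Bool as Bool using (Bool; true; false; if_then_else_; not)
open import Data.Bool.Properties using (¬-not)
open import Data.Empty using (⊥-elim)
open import Data.Fin as Fin using (Fin; zero; suc; toℕ; punchIn; _≟_; _<_)
open import Data.Fin.Properties using (all?; any?; <-cmp; <⇒≢; punchIn-injective; punchInᵢ≢i; punchOut-punchIn)
import Data.Fin.Permutation as Perm
open import Data.Fin.Permutation using (Permutation′; _⟨$⟩ʳ_; _⟨$⟩ˡ_; inverseˡ)
import Data.Fin.Permutation.Components as PC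
open import Data.Fin.Subset using (Subset; inside; outside; ∁)
open import Data.Integer as ℤ using (+_)
import Data.Integer.Properties as ℤₚ
open import Data.Integer.Tactic.RingSolver using (solve-∀)
open import Data.List as List using ([]; _∷_)
open import Data.List.Properties using (∷-injective)
open import Data.Maybe as Maybe using (just; nothing; maybe; fromMaybe)
open import Data.Nat as ℕ using (ℕ; zero; suc; _+_; _*_; _∸_; _≤_; z≤n; s≤s)
open import Data.Nat.DivMod using (_mod_)
import Data.Nat.Properties as ℕₚ
open import Data.Product using (Σ; ∃; ∃₂; _×_; _,_; proj₁; proj₂; map₂)
open import Data.Sum as Sum using (_⊎_; inj₁; inj₂)
open import Data.Unit using (⊤; tt)
open import Data.Vec as Vec using (Vec; []; _∷_; lookup; removeAt; allFin)
open import Data.Vec.Properties using (lookup-map; map-∘; lookup-allFin; allFin-map; removeAt-punchOut)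
open import Function using (_∘_)
open import Relation.Binary.Construct.Closure.ReflexiveTransitive using (ε; _◅_)
open import Relation.Binary.Definitions using (DecidableEquality; Tri; tri<; tri≈; tri>)
open import Relation.Binary.PropositionalEquality
open import Relation.Nullary using (does; yes; no)
open import Relation.Nullary.Decidable using (True; toWitness; map′; _×-dec_; dec-true; dec-false)

open CommutativeSemigroupProperties ℤₚ.+-commutativeSemigroup using (interchange; x∙yz≈y∙xz)
open import Algebra.Properties.Group (AbelianGroup.group ℤₚ.+-0-abelianGroup) using (∙-cancelʳ)

_≟ᵉ_ : DecidableEquality ℤω
ew a b ≟ᵉ ew c d =
  map′ (λ (p , q) → cong₂ ew p q) (λ { refl → refl , refl }) (a ℤ.≟ c ×-dec b ℤ.≟ d)

+ᵉ-comm : ∀ x y → x +ᵉ y ≡ y +ᵉ x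
+ᵉ-comm (ew a b) (ew c d) = cong₂ ew (ℤₚ.+-comm a c) (ℤₚ.+-comm b d)

+ᵉ-identityˡ : ∀ x → 0ᵉ +ᵉ x ≡ x
+ᵉ-identityˡ (ew a b) = cong₂ ew (ℤₚ.+-identityˡ a) (ℤₚ.+-identityˡ b)

+ᵉ-identityʳ : ∀ x → x +ᵉ 0ᵉ ≡ x
+ᵉ-identityʳ (ew a b) = cong₂ ew (ℤₚ.+-identityʳ a) (ℤₚ.+-identityʳ b)

+ᵉ-interchange : ∀ w x y z → (w +ᵉ x) +ᵉ (y +ᵉ z) ≡ (w +ᵉ y) +ᵉ (x +ᵉ z)
+ᵉ-interchange (ew a₁ a₂) (ew b₁ b₂) (ew c₁ c₂) (ew d₁ d₂) =
  cong₂ ew (interchange a₁ b₁ c₁ d₁) (interchange a₂ b₂ c₂ d₂)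

+ᵉ-leftComm : ∀ x y z → x +ᵉ (y +ᵉ z) ≡ y +ᵉ (x +ᵉ z)
+ᵉ-leftComm (ew a₁ a₂) (ew b₁ b₂) (ew c₁ c₂) =
  cong₂ ew (x∙yz≈y∙xz a₁ b₁ c₁) (x∙yz≈y∙xz a₂ b₂ c₂)

-ᵉ-distrib-+ᵉ : ∀ x y → -ᵉ (x +ᵉ y) ≡ -ᵉ x +ᵉ -ᵉ y
-ᵉ-distrib-+ᵉ (ew a b) (ew c d) = cong₂ ew (ℤₚ.neg-distrib-+ a c) (ℤₚ.neg-distrib-+ b d)

-ᵉ-involutive : ∀ x → -ᵉ -ᵉ x ≡ x
-ᵉ-involutive (ew a b) = cong₂ ew (ℤₚ.neg-involutive a) (ℤₚ.neg-involutive b)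

0ᵉ≢1ᵉ : 0ᵉ ≢ 1ᵉ
0ᵉ≢1ᵉ ()

-ᵉ-injective : ∀ {x y} → -ᵉ x ≡ -ᵉ y → x ≡ y
-ᵉ-injective {x} {y} eq = trans (sym (-ᵉ-involutive x)) (trans (cong -ᵉ_ eq) (-ᵉ-involutive y))

*ᵉ-zeroˡ : ∀ x → 0ᵉ *ᵉ x ≡ 0ᵉ
*ᵉ-zeroˡ (ew a b) = cong₂ ew (re a b) (im a b)
  where
  re : ∀ a b → + 0 ℤ.* a ℤ.- + 0 ℤ.* b ≡ + 0
  re = solve-∀
  im : ∀ a b → + 0 ℤ.* b ℤ.+ + 0 ℤ.* a ℤ.+ + 0 ℤ.* b ≡ + 0
  im = solve-∀

*ᵉ-zeroʳ : ∀ x → x *ᵉ 0ᵉ ≡ 0ᵉ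
*ᵉ-zeroʳ (ew a b) = cong₂ ew (re a b) (im a b)
  where
  re : ∀ a b → a ℤ.* + 0 ℤ.- b ℤ.* + 0 ≡ + 0
  re = solve-∀
  im : ∀ a b → a ℤ.* + 0 ℤ.+ b ℤ.* + 0 ℤ.+ b ℤ.* + 0 ≡ + 0
  im = solve-∀

*ᵉ-identityˡ : ∀ x → 1ᵉ *ᵉ x ≡ x
*ᵉ-identityˡ (ew a b) = cong₂ ew (re a b) (im a b)
  where
  re : ∀ a b → + 1 ℤ.* a ℤ.- + 0 ℤ.* b ≡ a
  re = solve-∀
  im : ∀ a b → + 1 ℤ.* b ℤ.+ + 0 ℤ.* a ℤ.+ + 0 ℤ.* b ≡ b
  im = solve-∀

*ᵉ-distribˡ-+ᵉ : ∀ x y z → x *ᵉ (y +ᵉ z) ≡ x *ᵉ y +ᵉ x *ᵉ z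
*ᵉ-distribˡ-+ᵉ (ew a b) (ew c d) (ew e f) = cong₂ ew (re a b c d e f) (im a b c d e f)
  where
  re : ∀ a b c d e f → a ℤ.* (c ℤ.+ e) ℤ.- b ℤ.* (d ℤ.+ f)
                     ≡ (a ℤ.* c ℤ.- b ℤ.* d) ℤ.+ (a ℤ.* e ℤ.- b ℤ.* f)
  re = solve-∀
  im : ∀ a b c d e f → a ℤ.* (d ℤ.+ f) ℤ.+ b ℤ.* (c ℤ.+ e) ℤ.+ b ℤ.* (d ℤ.+ f)
                     ≡ (a ℤ.* d ℤ.+ b ℤ.* c ℤ.+ b ℤ.* d) ℤ.+ (a ℤ.* f ℤ.+ b ℤ.* e ℤ.+ b ℤ.* f)
  im = solve-∀

-ᵉ-distribʳ-*ᵉ : ∀ x y → -ᵉ (x *ᵉ y) ≡ x *ᵉ -ᵉ y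
-ᵉ-distribʳ-*ᵉ (ew a b) (ew c d) = cong₂ ew (re a b c d) (im a b c d)
  where
  re : ∀ a b c d → ℤ.- (a ℤ.* c ℤ.- b ℤ.* d) ≡ a ℤ.* (ℤ.- c) ℤ.- b ℤ.* (ℤ.- d)
  re = solve-∀
  im : ∀ a b c d → ℤ.- (a ℤ.* d ℤ.+ b ℤ.* c ℤ.+ b ℤ.* d) ≡ a ℤ.* (ℤ.- d) ℤ.+ b ℤ.* (ℤ.- c) ℤ.+ b ℤ.* (ℤ.- d)
  im = solve-∀

-- The group 𝕋₆, written additively on exponents

infixl 6 _⊕_
infix 8 ⊖_

_⊕_ : T6 → T6 → T6
a ⊕ b = (toℕ a + toℕ b) mod 6

⊖_ : T6 → T6
⊖_ = conj6

ω ω̄ : T6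
ω = suc zero
ω̄ = ⊖ ω

module _ {A : Set} (_≟A_ : DecidableEquality A) where

  exhaustive₁ : {f g : T6 → A} {_ : True (all? λ a → f a ≟A g a)} → ∀ a → f a ≡ g a
  exhaustive₁ {_} {_} {p} = toWitness p

  exhaustive₂ : {f g : T6 → T6 → A} {_ : True (all? λ a → all? λ b → f a b ≟A g a b)} →
                ∀ a b → f a b ≡ g a b
  exhaustive₂ {_} {_} {p} = toWitness p

  exhaustive₃ : {f g : T6 → T6 → T6 → A}
                {_ : True (all? λ a → all? λ b → all? λ c → f a b c ≟A g a b c)} →
                ∀ a b c → f a b c ≡ g a b c
  exhaustive₃ {_} {_} {p} = toWitness p

  exhaustive₄ : {f g : T6 → T6 → T6 → T6 → A}
                {_ : True (all? λ a → all? λ b → all? λ c → all? λ d → f a b c d ≟A g a b c d)} →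
                ∀ a b c d → f a b c d ≡ g a b c d
  exhaustive₄ {_} {_} {p} = toWitness p

  exhaustive₅ : {f g : T6 → T6 → T6 → T6 → T6 → A}
                {_ : True (all? λ a → all? λ b → all? λ c → all? λ d → all? λ e → f a b c d e ≟A g a b c d e)} →
                ∀ a b c d e → f a b c d e ≡ g a b c d e
  exhaustive₅ {_} {_} {p} = toWitness p

  exhaustive₆ : {f g : T6 → T6 → T6 → T6 → T6 → T6 → A}
                {_ : True (all? λ a → all? λ b → all? λ c → all? λ d → all? λ e → all? λ h →
                           f a b c d e h ≟A g a b c d e h)} →
                ∀ a b c d e h → f a b c d e h ≡ g a b c d e h
  exhaustive₆ {_} {_} {p} = toWitness p

toℤω-⊕ : ∀ a b → toℤω (a ⊕ b) ≡ toℤω a *ᵉ toℤω b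
toℤω-⊕ = exhaustive₂ _≟ᵉ_

toℤω-⊖ : ∀ a → toℤω (⊖ a) ≡ conjᵉ (toℤω a)
toℤω-⊖ = exhaustive₁ _≟ᵉ_

⊕-identityˡ : ∀ a → zero ⊕ a ≡ a
⊕-identityˡ = exhaustive₁ _≟_

⊕-identityʳ : ∀ a → a ⊕ zero ≡ a
⊕-identityʳ = exhaustive₁ _≟_

⊕-⊖-⊕ : ∀ a b → a ⊕ ⊖ b ⊕ b ≡ a
⊕-⊖-⊕ = exhaustive₂ _≟_

⊕-rotate₃ : ∀ a b c → a ⊕ b ⊕ c ≡ b ⊕ c ⊕ a
⊕-rotate₃ = exhaustive₃ _≟_

⊖-reverse₃ : ∀ a b c → ⊖ a ⊕ ⊖ c ⊕ ⊖ b ≡ ⊖ (a ⊕ b ⊕ c)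
⊖-reverse₃ = exhaustive₃ _≟_

⊖-conjugate : ∀ a g b → b ⊕ ⊖ g ⊕ ⊖ a ≡ ⊖ (a ⊕ g ⊕ ⊖ b)
⊖-conjugate = exhaustive₃ _≟_

⊕-zero-⊖ : ∀ a → a ⊕ zero ⊕ ⊖ a ≡ zero
⊕-zero-⊖ = exhaustive₁ _≟_

zero-⊕-⊖ : ∀ a → zero ⊕ a ⊕ ⊖ a ≡ zero
zero-⊕-⊖ = exhaustive₁ _≟_

conjugates-telescope : ∀ a b c p q r → (a ⊕ p ⊕ ⊖ b) ⊕ (b ⊕ q ⊕ ⊖ c) ⊕ (c ⊕ r ⊕ ⊖ a) ≡ p ⊕ q ⊕ r
conjugates-telescope = exhaustive₆ _≟_

⊕-inverseʳ : ∀ a → a ⊕ ⊖ a ≡ zero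
⊕-inverseʳ = exhaustive₁ _≟_

⊕-zero-middle : ∀ a b → a ⊕ zero ⊕ ⊖ b ≡ a ⊕ ⊖ b
⊕-zero-middle = exhaustive₂ _≟_

⊖-difference : ∀ a b → ⊖ (a ⊕ ⊖ b) ≡ b ⊕ ⊖ a
⊖-difference = exhaustive₂ _≟_

⊕-⊖-interchange : ∀ a b c d → a ⊕ ⊖ b ⊕ (c ⊕ ⊖ d) ≡ (a ⊕ c) ⊕ ⊖ (b ⊕ d)
⊕-⊖-interchange = exhaustive₄ _≟_

⊕-⊖-regroup : ∀ t a g u b → (t ⊕ a) ⊕ g ⊕ ⊖ (u ⊕ b) ≡ (a ⊕ ⊖ b) ⊕ (t ⊕ g ⊕ ⊖ u)
⊕-⊖-regroup = exhaustive₅ _≟_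

⊕-⊖-cancel : ∀ a b → a ⊕ ⊖ b ≡ zero → a ≡ b
⊕-⊖-cancel a b a⊖b≡0 = begin
  a             ≡⟨ ⊕-⊖-⊕ a b ⟨
  a ⊕ ⊖ b ⊕ b   ≡⟨ cong (_⊕ b) a⊖b≡0 ⟩
  zero ⊕ b      ≡⟨ ⊕-identityˡ b ⟩
  b             ∎
  where open ≡-Reasoning

-- defect t = |1 - ω^t|² = 2 - 2 Re ω^t
defect : T6 → ℕ
defect zero = 0
defect (suc zero) = 1
defect (suc (suc zero)) = 3
defect (suc (suc (suc zero))) = 4
defect (suc (suc (suc (suc zero)))) = 3
defect (suc (suc (suc (suc (suc zero))))) = 1

defect≡0⇒≡zero : ∀ t → defect t ≡ 0 → t ≡ zero
defect≡0⇒≡zero zero _ = refl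
defect≡0⇒≡zero (suc zero) ()
defect≡0⇒≡zero (suc (suc zero)) ()
defect≡0⇒≡zero (suc (suc (suc zero))) ()
defect≡0⇒≡zero (suc (suc (suc (suc zero)))) ()
defect≡0⇒≡zero (suc (suc (suc (suc (suc zero))))) ()

defect≡1⇒ω⊎ω̄ : ∀ t → defect t ≡ 1 → t ≡ ω ⊎ t ≡ ω̄
defect≡1⇒ω⊎ω̄ zero ()
defect≡1⇒ω⊎ω̄ (suc zero) _ = inj₁ refl
defect≡1⇒ω⊎ω̄ (suc (suc zero)) ()
defect≡1⇒ω⊎ω̄ (suc (suc (suc zero))) ()
defect≡1⇒ω⊎ω̄ (suc (suc (suc (suc zero)))) ()
defect≡1⇒ω⊎ω̄ (suc (suc (suc (suc (suc zero))))) _ = inj₂ refl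

defect-⊖ : ∀ t → defect (⊖ t) ≡ defect t
defect-⊖ = exhaustive₁ ℕₚ._≟_

defect-positive : ∀ t → t ≢ zero → 0 ℕ.< defect t
defect-positive zero t≢0 = ⊥-elim (t≢0 refl)
defect-positive (suc zero) _ = s≤s z≤n
defect-positive (suc (suc zero)) _ = s≤s z≤n
defect-positive (suc (suc (suc zero))) _ = s≤s z≤n
defect-positive (suc (suc (suc (suc zero)))) _ = s≤s z≤n
defect-positive (suc (suc (suc (suc (suc zero))))) _ = s≤s z≤n

-- Laplace expansion and principal minors

Matrix : ℕ → Set
Matrix n = Fin n → Fin n → ℤω

minor : ∀ {n} → Fin (suc n) → Fin (suc n) → Matrix (suc n) → Matrix n
minor r c M i j = M (punchIn r i) (punchIn c j)

altSumᵉ : ∀ {k} → (Fin k → ℤω) → ℤω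
altSumᵉ {zero} f = 0ᵉ
altSumᵉ {suc k} f = f zero +ᵉ -ᵉ altSumᵉ (f ∘ suc)

detᵉ : ∀ n → Matrix n → ℤω
detᵉ zero M = 1ᵉ
detᵉ (suc n) M = altSumᵉ (λ j → M zero j *ᵉ detᵉ n (minor zero j M))

δ : ∀ {n} → Matrix n
δ i j = if does (i ≟ j) then 1ᵉ else 0ᵉ

neg^ : ℕ → ℤω → ℤω
neg^ zero x = x
neg^ (suc k) x = -ᵉ neg^ k x

negateIf : Bool → ℤω → ℤω
negateIf b x = if b then -ᵉ x else x

-- toℕ c ≤ᵇ toℕ j, by recursion on Fin so that it reduces under suc
_≤ᶠ_ : ∀ {m n} → Fin m → Fin n → Bool
zero ≤ᶠ j = true
suc c ≤ᶠ zero = false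
suc c ≤ᶠ suc j = c ≤ᶠ j

altSumᵉ-cong : ∀ {k} {f g : Fin k → ℤω} → (∀ j → f j ≡ g j) → altSumᵉ f ≡ altSumᵉ g
altSumᵉ-cong {zero} f≗g = refl
altSumᵉ-cong {suc k} f≗g = cong₂ (λ a b → a +ᵉ -ᵉ b) (f≗g zero) (altSumᵉ-cong (f≗g ∘ suc))

detᵉ-cong : ∀ n {M N : Matrix n} → (∀ i j → M i j ≡ N i j) → detᵉ n M ≡ detᵉ n N
detᵉ-cong zero M≗N = refl
detᵉ-cong (suc n) M≗N =
  altSumᵉ-cong (λ j → cong₂ _*ᵉ_ (M≗N zero j) (detᵉ-cong n (λ r c → M≗N (suc r) (punchIn j c))))

altSumᵉ-zero : ∀ k → altSumᵉ {k} (λ _ → 0ᵉ) ≡ 0ᵉ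
altSumᵉ-zero zero = refl
altSumᵉ-zero (suc k) = cong (λ x → 0ᵉ +ᵉ -ᵉ x) (altSumᵉ-zero k)

altSumᵉ-neg : ∀ {k} (f : Fin k → ℤω) → altSumᵉ (-ᵉ_ ∘ f) ≡ -ᵉ altSumᵉ f
altSumᵉ-neg {zero} f = refl
altSumᵉ-neg {suc k} f = trans (cong (λ x → -ᵉ f zero +ᵉ -ᵉ x) (altSumᵉ-neg (f ∘ suc)))
                              (sym (-ᵉ-distrib-+ᵉ (f zero) _))

altSumᵉ-neg^ : ∀ {k} m (f : Fin k → ℤω) → altSumᵉ (neg^ m ∘ f) ≡ neg^ m (altSumᵉ f)
altSumᵉ-neg^ zero f = refl
altSumᵉ-neg^ (suc m) f = trans (altSumᵉ-neg (neg^ m ∘ f)) (cong -ᵉ_ (altSumᵉ-neg^ m f))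

altSumᵉ-+ : ∀ {k} (f g : Fin k → ℤω) → altSumᵉ (λ j → f j +ᵉ g j) ≡ altSumᵉ f +ᵉ altSumᵉ g
altSumᵉ-+ {zero} f g = refl
altSumᵉ-+ {suc k} f g = begin
  f zero +ᵉ g zero +ᵉ -ᵉ altSumᵉ (λ j → f (suc j) +ᵉ g (suc j))
    ≡⟨ cong (λ x → f zero +ᵉ g zero +ᵉ -ᵉ x) (altSumᵉ-+ (f ∘ suc) (g ∘ suc)) ⟩
  f zero +ᵉ g zero +ᵉ -ᵉ (altSumᵉ (f ∘ suc) +ᵉ altSumᵉ (g ∘ suc))
    ≡⟨ cong (f zero +ᵉ g zero +ᵉ_) (-ᵉ-distrib-+ᵉ (altSumᵉ (f ∘ suc)) (altSumᵉ (g ∘ suc))) ⟩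
  f zero +ᵉ g zero +ᵉ (-ᵉ altSumᵉ (f ∘ suc) +ᵉ -ᵉ altSumᵉ (g ∘ suc))
    ≡⟨ +ᵉ-interchange (f zero) (g zero) (-ᵉ altSumᵉ (f ∘ suc)) (-ᵉ altSumᵉ (g ∘ suc)) ⟩
  altSumᵉ f +ᵉ altSumᵉ g ∎
  where open ≡-Reasoning

altSumᵉ-*ˡ : ∀ {k} a (f : Fin k → ℤω) → altSumᵉ (λ j → a *ᵉ f j) ≡ a *ᵉ altSumᵉ f
altSumᵉ-*ˡ {zero} a f = sym (*ᵉ-zeroʳ a)
altSumᵉ-*ˡ {suc k} a f = begin
  a *ᵉ f zero +ᵉ -ᵉ altSumᵉ (λ j → a *ᵉ f (suc j))  ≡⟨ cong (λ x → a *ᵉ f zero +ᵉ -ᵉ x) (altSumᵉ-*ˡ a (f ∘ suc)) ⟩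
  a *ᵉ f zero +ᵉ -ᵉ (a *ᵉ altSumᵉ (f ∘ suc))       ≡⟨ cong (a *ᵉ f zero +ᵉ_) (-ᵉ-distribʳ-*ᵉ a _) ⟩
  a *ᵉ f zero +ᵉ a *ᵉ -ᵉ altSumᵉ (f ∘ suc)         ≡⟨ *ᵉ-distribˡ-+ᵉ a _ _ ⟨
  a *ᵉ altSumᵉ f                                   ∎
  where open ≡-Reasoning

neg^-*ʳ : ∀ m a x → a *ᵉ neg^ m x ≡ neg^ m (a *ᵉ x)
neg^-*ʳ zero a x = refl
neg^-*ʳ (suc m) a x = trans (sym (-ᵉ-distribʳ-*ᵉ a _)) (cong -ᵉ_ (neg^-*ʳ m a x))

neg^-zero : ∀ m → neg^ m 0ᵉ ≡ 0ᵉ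
neg^-zero zero = refl
neg^-zero (suc m) = cong -ᵉ_ (neg^-zero m)

neg^-double : ∀ m x → neg^ (m ℕ.+ m) x ≡ x
neg^-double zero x = refl
neg^-double (suc m) x = begin
  -ᵉ neg^ (m ℕ.+ suc m) x    ≡⟨ cong (λ k → -ᵉ neg^ k x) (ℕₚ.+-suc m m) ⟩
  -ᵉ -ᵉ neg^ (m ℕ.+ m) x     ≡⟨ -ᵉ-involutive _ ⟩
  neg^ (m ℕ.+ m) x           ≡⟨ neg^-double m x ⟩
  x                          ∎
  where open ≡-Reasoning

altSumᵉ-extract : ∀ {k} (f : Fin (suc k) → ℤω) c →
  altSumᵉ f ≡ neg^ (toℕ c) (f c) +ᵉ altSumᵉ (λ j → negateIf (c ≤ᶠ j) (f (punchIn c j)))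
altSumᵉ-extract f zero = cong (f zero +ᵉ_) (sym (altSumᵉ-neg (f ∘ suc)))
altSumᵉ-extract {suc k} f (suc c) = begin
  f zero +ᵉ -ᵉ altSumᵉ (f ∘ suc)
    ≡⟨ cong (λ x → f zero +ᵉ -ᵉ x) (altSumᵉ-extract (f ∘ suc) c) ⟩
  f zero +ᵉ -ᵉ (neg^ (toℕ c) (f (suc c)) +ᵉ rest)
    ≡⟨ cong (f zero +ᵉ_) (-ᵉ-distrib-+ᵉ (neg^ (toℕ c) (f (suc c))) rest) ⟩
  f zero +ᵉ (neg^ (suc (toℕ c)) (f (suc c)) +ᵉ -ᵉ rest)
    ≡⟨ +ᵉ-leftComm (f zero) (neg^ (suc (toℕ c)) (f (suc c))) (-ᵉ rest) ⟩
  neg^ (suc (toℕ c)) (f (suc c)) +ᵉ (f zero +ᵉ -ᵉ rest) ∎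
  where
  open ≡-Reasoning
  rest = altSumᵉ (λ j → negateIf (c ≤ᶠ j) (f (suc (punchIn c j))))

δ-punchIn : ∀ {n} (p : Fin (suc n)) i j → δ (punchIn p i) (punchIn p j) ≡ δ i j
δ-punchIn p i j with punchIn p i ≟ punchIn p j | i ≟ j
... | yes _  | yes _   = refl
... | no _   | no _    = refl
... | yes eq | no i≢j  = ⊥-elim (i≢j (punchIn-injective p i j eq))
... | no ≢   | yes refl = ⊥-elim (≢ refl)

δ-punchIn-self : ∀ {n} (c : Fin (suc n)) j → δ c (punchIn c j) ≡ 0ᵉ
δ-punchIn-self c j with c ≟ punchIn c j
... | yes eq = ⊥-elim (punchInᵢ≢i c j (sym eq))
... | no _ = refl

δ-self : ∀ {n} (c : Fin n) → δ c c ≡ 1ᵉ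
δ-self c with c ≟ c
... | yes _ = refl
... | no c≢c = ⊥-elim (c≢c refl)

detᵉ-zeroRow : ∀ n (M : Matrix (suc n)) r → (∀ j → M r j ≡ 0ᵉ) → detᵉ (suc n) M ≡ 0ᵉ
detᵉ-zeroRow n M zero row≡0 =
  trans (altSumᵉ-cong (λ j → trans (cong (_*ᵉ D j) (row≡0 j)) (*ᵉ-zeroˡ (D j)))) (altSumᵉ-zero (suc n))
  where
  D = λ j → detᵉ n (minor zero j M)
detᵉ-zeroRow (suc n) M (suc r) row≡0 =
  trans (altSumᵉ-cong (λ j → trans (cong (M zero j *ᵉ_) (minor≡0 j)) (*ᵉ-zeroʳ (M zero j)))) (altSumᵉ-zero (suc (suc n)))
  where
  minor≡0 : ∀ j → detᵉ (suc n) (minor zero j M) ≡ 0ᵉ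
  minor≡0 j = detᵉ-zeroRow n (minor zero j M) r (row≡0 ∘ punchIn j)

-- c′ is the position of column c in the minor that deletes column punchIn c j
punchIn-exchange : ∀ {n} (c : Fin (suc (suc n))) (j : Fin (suc n)) → ∃ λ c′ →
  punchIn (punchIn c j) c′ ≡ c ×
  (∀ b → punchIn (punchIn c j) (punchIn c′ b) ≡ punchIn c (punchIn j b)) ×
  (c ≤ᶠ j ≡ true × toℕ c′ ≡ toℕ c ⊎ c ≤ᶠ j ≡ false × suc (toℕ c′) ≡ toℕ c)
punchIn-exchange zero j = zero , refl , (λ b → refl) , inj₁ (refl , refl)
punchIn-exchange (suc c) zero = c , refl , (λ b → refl) , inj₂ (refl , refl)
punchIn-exchange {suc n} (suc c) (suc j) with punchIn-exchange c j
... | c′ , c′↦c , commute , position =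
  suc c′ , cong suc c′↦c , commute′ , Sum.map (map₂ (cong suc)) (map₂ (cong suc)) position
  where
  commute′ : ∀ b → punchIn (punchIn (suc c) (suc j)) (punchIn (suc c′) b) ≡ punchIn (suc c) (punchIn (suc j) b)
  commute′ zero = refl
  commute′ (suc b) = cong suc (commute b)

exchange-sign : ∀ {n} (c : Fin (suc (suc n))) (j c′ : Fin (suc n)) →
  (c ≤ᶠ j ≡ true × toℕ c′ ≡ toℕ c ⊎ c ≤ᶠ j ≡ false × suc (toℕ c′) ≡ toℕ c) → ∀ r x →
  negateIf (c ≤ᶠ j) (neg^ (r ℕ.+ toℕ c′) x) ≡ neg^ (suc (r ℕ.+ toℕ c)) x
exchange-sign c j c′ (inj₁ (after , same)) r x rewrite after | same = refl
exchange-sign c j c′ (inj₂ (before , shifted)) r x rewrite before | sym shifted | ℕₚ.+-suc r (toℕ c′) =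
  sym (-ᵉ-involutive _)

detᵉ-unitRow₀ : ∀ n (M : Matrix (suc n)) c → (∀ j → M zero j ≡ δ c j) →
  detᵉ (suc n) M ≡ neg^ (toℕ c) (detᵉ n (minor zero c M))
detᵉ-unitRow₀ n M c row≡δ = begin
  altSumᵉ (λ j → M zero j *ᵉ D j)
    ≡⟨ altSumᵉ-extract (λ j → M zero j *ᵉ D j) c ⟩
  neg^ (toℕ c) (M zero c *ᵉ D c) +ᵉ altSumᵉ (λ j → negateIf (c ≤ᶠ j) (M zero (punchIn c j) *ᵉ D (punchIn c j)))
    ≡⟨ cong₂ _+ᵉ_ (cong (neg^ (toℕ c)) pivot) (trans (altSumᵉ-cong offPivot) (altSumᵉ-zero n)) ⟩
  neg^ (toℕ c) (D c) +ᵉ 0ᵉ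
    ≡⟨ +ᵉ-identityʳ (neg^ (toℕ c) (D c)) ⟩
  neg^ (toℕ c) (D c) ∎
  where
  open ≡-Reasoning
  D = λ j → detᵉ n (minor zero j M)
  pivot : M zero c *ᵉ D c ≡ D c
  pivot = trans (cong (_*ᵉ D c) (trans (row≡δ c) (δ-self c))) (*ᵉ-identityˡ (D c))
  negateIf-zero : ∀ b → negateIf b 0ᵉ ≡ 0ᵉ
  negateIf-zero true = refl
  negateIf-zero false = refl
  offPivot : ∀ j → negateIf (c ≤ᶠ j) (M zero (punchIn c j) *ᵉ D (punchIn c j)) ≡ 0ᵉ
  offPivot j = begin
    negateIf (c ≤ᶠ j) (M zero (punchIn c j) *ᵉ D (punchIn c j))
      ≡⟨ cong (λ x → negateIf (c ≤ᶠ j) (x *ᵉ D (punchIn c j))) (trans (row≡δ (punchIn c j)) (δ-punchIn-self c j)) ⟩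
    negateIf (c ≤ᶠ j) (0ᵉ *ᵉ D (punchIn c j))
      ≡⟨ cong (negateIf (c ≤ᶠ j)) (*ᵉ-zeroˡ (D (punchIn c j))) ⟩
    negateIf (c ≤ᶠ j) 0ᵉ
      ≡⟨ negateIf-zero (c ≤ᶠ j) ⟩
    0ᵉ ∎

detᵉ-unitRow : ∀ n (M : Matrix (suc n)) r c → (∀ j → M r j ≡ δ c j) →
  detᵉ (suc n) M ≡ neg^ (toℕ r ℕ.+ toℕ c) (detᵉ n (minor r c M))
detᵉ-unitRow n M zero c row≡δ = detᵉ-unitRow₀ n M c row≡δ
detᵉ-unitRow (suc n) M (suc r) c row≡δ = begin
  altSumᵉ (λ j → M zero j *ᵉ D j)
    ≡⟨ altSumᵉ-extract (λ j → M zero j *ᵉ D j) c ⟩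
  neg^ (toℕ c) (M zero c *ᵉ D c) +ᵉ altSumᵉ (λ j → negateIf (c ≤ᶠ j) (M zero (punchIn c j) *ᵉ D (punchIn c j)))
    ≡⟨ cong₂ _+ᵉ_ pivot (altSumᵉ-cong offPivot) ⟩
  0ᵉ +ᵉ altSumᵉ (λ j → neg^ sign (minor (suc r) c M zero j *ᵉ detᵉ n (minor zero j (minor (suc r) c M))))
    ≡⟨ +ᵉ-identityˡ _ ⟩
  altSumᵉ (λ j → neg^ sign (minor (suc r) c M zero j *ᵉ detᵉ n (minor zero j (minor (suc r) c M))))
    ≡⟨ altSumᵉ-neg^ sign (λ j → minor (suc r) c M zero j *ᵉ detᵉ n (minor zero j (minor (suc r) c M))) ⟩
  neg^ sign (detᵉ (suc n) (minor (suc r) c M)) ∎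
  where
  open ≡-Reasoning
  sign = suc (toℕ r ℕ.+ toℕ c)
  D = λ j → detᵉ (suc n) (minor zero j M)
  pivot : neg^ (toℕ c) (M zero c *ᵉ D c) ≡ 0ᵉ
  pivot = begin
    neg^ (toℕ c) (M zero c *ᵉ D c)
      ≡⟨ cong (λ x → neg^ (toℕ c) (M zero c *ᵉ x))
              (detᵉ-zeroRow n (minor zero c M) r (λ j → trans (row≡δ (punchIn c j)) (δ-punchIn-self c j))) ⟩
    neg^ (toℕ c) (M zero c *ᵉ 0ᵉ)  ≡⟨ cong (neg^ (toℕ c)) (*ᵉ-zeroʳ (M zero c)) ⟩
    neg^ (toℕ c) 0ᵉ                ≡⟨ neg^-zero (toℕ c) ⟩
    0ᵉ                             ∎
  offPivot : ∀ j → negateIf (c ≤ᶠ j) (M zero (punchIn c j) *ᵉ D (punchIn c j))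
                 ≡ neg^ sign (M zero (punchIn c j) *ᵉ detᵉ n (minor zero j (minor (suc r) c M)))
  offPivot j with punchIn-exchange c j
  ... | c′ , c′↦c , commute , position = begin
    negateIf (c ≤ᶠ j) (a *ᵉ D (punchIn c j))
      ≡⟨ cong (λ x → negateIf (c ≤ᶠ j) (a *ᵉ x)) (detᵉ-unitRow n (minor zero (punchIn c j) M) r c′ unitRow) ⟩
    negateIf (c ≤ᶠ j) (a *ᵉ neg^ (toℕ r ℕ.+ toℕ c′) D′)
      ≡⟨ cong (negateIf (c ≤ᶠ j)) (neg^-*ʳ (toℕ r ℕ.+ toℕ c′) a D′) ⟩
    negateIf (c ≤ᶠ j) (neg^ (toℕ r ℕ.+ toℕ c′) (a *ᵉ D′))
      ≡⟨ exchange-sign c j c′ position (toℕ r) (a *ᵉ D′) ⟩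
    neg^ sign (a *ᵉ D′)
      ≡⟨ cong (λ x → neg^ sign (a *ᵉ x)) (detᵉ-cong n (λ i b → cong (M (suc (punchIn r i))) (commute b))) ⟩
    neg^ sign (a *ᵉ detᵉ n (minor zero j (minor (suc r) c M))) ∎
    where
    a = M zero (punchIn c j)
    D′ = detᵉ n (minor r c′ (minor zero (punchIn c j) M))
    unitRow : ∀ b → minor zero (punchIn c j) M r b ≡ δ c′ b
    unitRow b = begin
      M (suc r) (punchIn (punchIn c j) b)              ≡⟨ row≡δ _ ⟩
      δ c (punchIn (punchIn c j) b)                    ≡⟨ cong (λ x → δ x (punchIn (punchIn c j) b)) c′↦c ⟨
      δ (punchIn (punchIn c j) c′) (punchIn (punchIn c j) b) ≡⟨ δ-punchIn (punchIn c j) c′ b ⟩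
      δ c′ b                                           ∎

elements : ∀ {n} → Subset n → Σ ℕ (Vec (Fin n))
elements [] = 0 , []
elements (outside ∷ p) = proj₁ (elements p) , Vec.map suc (proj₂ (elements p))
elements (inside ∷ p) = suc (proj₁ (elements p)) , zero ∷ Vec.map suc (proj₂ (elements p))

size : ∀ {n} → Subset n → ℕ
size p = proj₁ (elements p)

principal : ∀ {n k} → Vec (Fin n) k → Matrix n → Matrix k
principal v M a b = M (lookup v a) (lookup v b)

principalMinor : ∀ {n} → Subset n → Matrix n → ℤω
principalMinor p M = detᵉ (size p) (principal (proj₂ (elements p)) M)

mixRows : ∀ {n} → Subset n → Matrix n → Matrix n → Matrix n
mixRows p M N r c = if lookup p r then M r c else N r c

elements-full : ∀ {n} (p : Subset n) → (∀ r → lookup p r ≡ inside) → elements p ≡ (n , allFin n)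
elements-full [] _ = refl
elements-full (outside ∷ p) allInside with () ← allInside zero
elements-full {suc n} (inside ∷ p) allInside
  rewrite elements-full p (allInside ∘ suc) | allFin-map n = refl

lookup-removeAt : ∀ {n} {A : Set} (xs : Vec A (suc n)) i j → lookup (removeAt xs i) j ≡ lookup xs (punchIn i j)
lookup-removeAt xs i j =
  trans (cong (lookup (removeAt xs i)) (sym (punchOut-punchIn i))) (removeAt-punchOut xs (punchInᵢ≢i i j ∘ sym))

map-suc-punchIn : ∀ {n k} (r : Fin (suc n)) (v : Vec (Fin n) k) →
  Vec.map suc (Vec.map (punchIn r) v) ≡ Vec.map (punchIn (suc r)) (Vec.map suc v)
map-suc-punchIn r v = trans (sym (map-∘ suc (punchIn r) v)) (map-∘ (punchIn (suc r)) suc v)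

elements-removeAt : ∀ {n} (p : Subset (suc n)) r → lookup p r ≡ outside →
  elements p ≡ (size (removeAt p r) , Vec.map (punchIn r) (proj₂ (elements (removeAt p r))))
elements-removeAt (outside ∷ p) zero refl = refl
elements-removeAt {suc n} (outside ∷ p@(_ ∷ _)) (suc r) out
  with elements (removeAt p r) | elements-removeAt p r out
... | k , v | eq rewrite eq = cong (k ,_) (map-suc-punchIn r v)
elements-removeAt {suc n} (inside ∷ p@(_ ∷ _)) (suc r) out
  with elements (removeAt p r) | elements-removeAt p r out
... | k , v | eq rewrite eq = cong (λ w → suc k , zero ∷ w) (map-suc-punchIn r v)

minor-mixRows : ∀ {n} (p : Subset (suc n)) r M a b →
  minor r r (mixRows p M δ) a b ≡ mixRows (removeAt p r) (minor r r M) δ a b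
minor-mixRows p r M a b rewrite lookup-removeAt p r a with lookup p (punchIn r a)
... | inside = refl
... | outside = δ-punchIn r a b

principalMinor-removeAt : ∀ {n} (p : Subset (suc n)) r M → lookup p r ≡ outside →
  principalMinor (removeAt p r) (minor r r M) ≡ principalMinor p M
principalMinor-removeAt p r M out = begin
  detᵉ k (principal v (minor r r M))
    ≡⟨ detᵉ-cong k (λ a b → sym (cong₂ M (lookup-map a (punchIn r) v) (lookup-map b (punchIn r) v))) ⟩
  detᵉ k (principal (Vec.map (punchIn r) v) M)
    ≡⟨ cong (λ (k , v) → detᵉ k (principal v M)) (sym (elements-removeAt p r out)) ⟩
  principalMinor p M ∎
  where
  open ≡-Reasoning
  k = size (removeAt p r)
  v = proj₂ (elements (removeAt p r))

-- The rows outside p are unit rows; expanding along them leaves the principal minor on p.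
detᵉ-mixRows-δ : ∀ n (p : Subset n) M → detᵉ n (mixRows p M δ) ≡ principalMinor p M
detᵉ-mixRows-δ zero [] M = refl
detᵉ-mixRows-δ (suc n) p M with any? (λ r → lookup p r Bool.≟ outside)
... | yes (r , out) = begin
  detᵉ (suc n) (mixRows p M δ)
    ≡⟨ detᵉ-unitRow n (mixRows p M δ) r r unitRow ⟩
  neg^ (toℕ r ℕ.+ toℕ r) (detᵉ n (minor r r (mixRows p M δ)))
    ≡⟨ neg^-double (toℕ r) (detᵉ n (minor r r (mixRows p M δ))) ⟩
  detᵉ n (minor r r (mixRows p M δ))
    ≡⟨ detᵉ-cong n (minor-mixRows p r M) ⟩
  detᵉ n (mixRows (removeAt p r) (minor r r M) δ)
    ≡⟨ detᵉ-mixRows-δ n (removeAt p r) (minor r r M) ⟩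
  principalMinor (removeAt p r) (minor r r M)
    ≡⟨ principalMinor-removeAt p r M out ⟩
  principalMinor p M ∎
  where
  open ≡-Reasoning
  unitRow : ∀ j → mixRows p M δ r j ≡ δ r j
  unitRow j rewrite out = refl
... | no noOutside = begin
  detᵉ (suc n) (mixRows p M δ)
    ≡⟨ detᵉ-cong (suc n) (λ r c → cong (λ b → if b then M r c else δ r c) (allInside r)) ⟩
  detᵉ (suc n) M
    ≡⟨ detᵉ-cong (suc n) (λ a b → sym (cong₂ M (lookup-allFin a) (lookup-allFin b))) ⟩
  detᵉ (suc n) (principal (allFin (suc n)) M)
    ≡⟨ cong (λ (k , v) → detᵉ k (principal v M)) (sym (elements-full p allInside)) ⟩
  principalMinor p M ∎
  where
  open ≡-Reasoning
  allInside : ∀ r → lookup p r ≡ inside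
  allInside r = ¬-not (λ out → noOutside (r , out))

-- Sums over the subsets of a given size

module _ {A : Set} (_∙_ : A → A → A) (ε : A) where

  sumSubsets : ∀ n → ℕ → (Subset n → A) → A
  sumSubsets zero zero f = f []
  sumSubsets zero (suc k) f = ε
  sumSubsets (suc n) zero f = sumSubsets n zero (f ∘ (outside ∷_))
  sumSubsets (suc n) (suc k) f = sumSubsets n (suc k) (f ∘ (outside ∷_)) ∙ sumSubsets n k (f ∘ (inside ∷_))

module _ {A : Set} {_∙_ : A → A → A} {ε : A} where

  sumSubsets-congOn : ∀ n k {f g : Subset n → A} → (∀ p → size p ≡ k → f p ≡ g p) →
    sumSubsets _∙_ ε n k f ≡ sumSubsets _∙_ ε n k g
  sumSubsets-congOn zero zero f≗g = f≗g [] refl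
  sumSubsets-congOn zero (suc k) f≗g = refl
  sumSubsets-congOn (suc n) zero f≗g = sumSubsets-congOn n zero (f≗g ∘ (outside ∷_))
  sumSubsets-congOn (suc n) (suc k) f≗g =
    cong₂ _∙_ (sumSubsets-congOn n (suc k) (f≗g ∘ (outside ∷_)))
              (sumSubsets-congOn n k (λ p size≡k → f≗g (inside ∷ p) (cong suc size≡k)))

  sumSubsets-ε : ε ∙ ε ≡ ε → ∀ n k → sumSubsets _∙_ ε n k (λ _ → ε) ≡ ε
  sumSubsets-ε ε∙ε zero zero = refl
  sumSubsets-ε ε∙ε zero (suc k) = refl
  sumSubsets-ε ε∙ε (suc n) zero = sumSubsets-ε ε∙ε n zero
  sumSubsets-ε ε∙ε (suc n) (suc k) =
    trans (cong₂ _∙_ (sumSubsets-ε ε∙ε n (suc k)) (sumSubsets-ε ε∙ε n k)) ε∙ε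

  sumSubsets-oversized : ε ∙ ε ≡ ε → ∀ n k (f : Subset n → A) → n ℕ.< k → sumSubsets _∙_ ε n k f ≡ ε
  sumSubsets-oversized ε∙ε zero (suc k) f n<k = refl
  sumSubsets-oversized ε∙ε (suc n) (suc k) f (s≤s n<k) =
    trans (cong₂ _∙_ (sumSubsets-oversized ε∙ε n (suc k) _ (ℕₚ.m≤n⇒m≤1+n n<k))
                     (sumSubsets-oversized ε∙ε n k _ n<k)) ε∙ε

  module _ {B : Set} {_∙′_ : B → B → B} {ε′ : B} (h : A → B)
           (h-ε : h ε ≡ ε′) (h-∙ : ∀ x y → h (x ∙ y) ≡ h x ∙′ h y) where

    sumSubsets-hom : ∀ n k (f : Subset n → A) → h (sumSubsets _∙_ ε n k f) ≡ sumSubsets _∙′_ ε′ n k (h ∘ f)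
    sumSubsets-hom zero zero f = refl
    sumSubsets-hom zero (suc k) f = h-ε
    sumSubsets-hom (suc n) zero f = sumSubsets-hom n zero (f ∘ (outside ∷_))
    sumSubsets-hom (suc n) (suc k) f =
      trans (h-∙ _ _) (cong₂ _∙′_ (sumSubsets-hom n (suc k) (f ∘ (outside ∷_))) (sumSubsets-hom n k (f ∘ (inside ∷_))))

sumᵉ : ∀ n → ℕ → (Subset n → ℤω) → ℤω
sumᵉ = sumSubsets _+ᵉ_ 0ᵉ

sumᵉ-+ : ∀ n k (f g : Subset n → ℤω) → sumᵉ n k (λ p → f p +ᵉ g p) ≡ sumᵉ n k f +ᵉ sumᵉ n k g
sumᵉ-+ zero zero f g = refl
sumᵉ-+ zero (suc k) f g = refl
sumᵉ-+ (suc n) zero f g = sumᵉ-+ n zero (f ∘ (outside ∷_)) (g ∘ (outside ∷_))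
sumᵉ-+ (suc n) (suc k) f g =
  trans (cong₂ _+ᵉ_ (sumᵉ-+ n (suc k) (f ∘ (outside ∷_)) (g ∘ (outside ∷_)))
                    (sumᵉ-+ n k (f ∘ (inside ∷_)) (g ∘ (inside ∷_))))
        (+ᵉ-interchange (sumᵉ n (suc k) (f ∘ (outside ∷_))) (sumᵉ n (suc k) (g ∘ (outside ∷_)))
                        (sumᵉ n k (f ∘ (inside ∷_))) (sumᵉ n k (g ∘ (inside ∷_))))

sumᵉ-altSumᵉ : ∀ n k {m} (a : Fin m → ℤω) (Y : Fin m → Subset n → ℤω) →
  sumᵉ n k (λ p → altSumᵉ (λ j → a j *ᵉ Y j p)) ≡ altSumᵉ (λ j → a j *ᵉ sumᵉ n k (Y j))
sumᵉ-altSumᵉ n k {zero} a Y = sumSubsets-ε refl n k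
sumᵉ-altSumᵉ n k {suc m} a Y = begin
  sumᵉ n k (λ p → a zero *ᵉ Y zero p +ᵉ -ᵉ altSumᵉ (λ j → a (suc j) *ᵉ Y (suc j) p))
    ≡⟨ sumᵉ-+ n k (λ p → a zero *ᵉ Y zero p) (λ p → -ᵉ altSumᵉ (λ j → a (suc j) *ᵉ Y (suc j) p)) ⟩
  sumᵉ n k (λ p → a zero *ᵉ Y zero p) +ᵉ sumᵉ n k (λ p → -ᵉ altSumᵉ (λ j → a (suc j) *ᵉ Y (suc j) p))
    ≡⟨ cong₂ _+ᵉ_ (sym (sumSubsets-hom (a zero *ᵉ_) (*ᵉ-zeroʳ (a zero)) (*ᵉ-distribˡ-+ᵉ (a zero)) n k (Y zero)))
                  (sym (sumSubsets-hom -ᵉ_ refl -ᵉ-distrib-+ᵉ n k (λ p → altSumᵉ (λ j → a (suc j) *ᵉ Y (suc j) p)))) ⟩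
  a zero *ᵉ sumᵉ n k (Y zero) +ᵉ -ᵉ sumᵉ n k (λ p → altSumᵉ (λ j → a (suc j) *ᵉ Y (suc j) p))
    ≡⟨ cong (λ x → a zero *ᵉ sumᵉ n k (Y zero) +ᵉ -ᵉ x) (sumᵉ-altSumᵉ n k (a ∘ suc) (Y ∘ suc)) ⟩
  altSumᵉ (λ j → a j *ᵉ sumᵉ n k (Y j)) ∎
  where open ≡-Reasoning

sumᵉ-∁ : ∀ n j k (f : Subset n → ℤω) → j + k ≡ n → sumᵉ n j (f ∘ ∁) ≡ sumᵉ n k f
sumᵉ-∁ zero zero zero f refl = refl
sumᵉ-∁ (suc n) zero (suc k) f refl = begin
  sumᵉ n zero (λ p → f (inside ∷ ∁ p))                         ≡⟨ sumᵉ-∁ n zero n (f ∘ (inside ∷_)) refl ⟩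
  sumᵉ n n (f ∘ (inside ∷_))                                   ≡⟨ +ᵉ-identityˡ (sumᵉ n n (f ∘ (inside ∷_))) ⟨
  0ᵉ +ᵉ sumᵉ n n (f ∘ (inside ∷_))                              ≡⟨ cong (_+ᵉ sumᵉ n n (f ∘ (inside ∷_))) empty ⟨
  sumᵉ n (suc n) (f ∘ (outside ∷_)) +ᵉ sumᵉ n n (f ∘ (inside ∷_)) ∎
  where
  open ≡-Reasoning
  empty = sumSubsets-oversized refl n (suc n) (f ∘ (outside ∷_)) ℕₚ.≤-refl
sumᵉ-∁ (suc n) (suc j) zero f j+0≡n
  with refl ← trans (sym (ℕₚ.+-identityʳ (suc j))) j+0≡n = begin
  sumᵉ j (suc j) (λ p → f (inside ∷ ∁ p)) +ᵉ sumᵉ j j (λ p → f (outside ∷ ∁ p))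
    ≡⟨ cong₂ _+ᵉ_ empty (sumᵉ-∁ j j zero (f ∘ (outside ∷_)) (ℕₚ.+-identityʳ j)) ⟩
  0ᵉ +ᵉ sumᵉ j zero (f ∘ (outside ∷_))
    ≡⟨ +ᵉ-identityˡ (sumᵉ j zero (f ∘ (outside ∷_))) ⟩
  sumᵉ j zero (f ∘ (outside ∷_)) ∎
  where
  open ≡-Reasoning
  empty = sumSubsets-oversized refl j (suc j) (λ p → f (inside ∷ ∁ p)) ℕₚ.≤-refl
sumᵉ-∁ (suc n) (suc j) (suc k) f sj+sk≡sn = begin
  sumᵉ n (suc j) (λ p → f (inside ∷ ∁ p)) +ᵉ sumᵉ n j (λ p → f (outside ∷ ∁ p))
    ≡⟨ cong₂ _+ᵉ_ (sumᵉ-∁ n (suc j) k (f ∘ (inside ∷_)) (trans (sym (ℕₚ.+-suc j k)) j+k≡n))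
                  (sumᵉ-∁ n j (suc k) (f ∘ (outside ∷_)) j+k≡n) ⟩
  sumᵉ n k (f ∘ (inside ∷_)) +ᵉ sumᵉ n (suc k) (f ∘ (outside ∷_))
    ≡⟨ +ᵉ-comm (sumᵉ n k (f ∘ (inside ∷_))) (sumᵉ n (suc k) (f ∘ (outside ∷_))) ⟩
  sumᵉ n (suc k) (f ∘ (outside ∷_)) +ᵉ sumᵉ n k (f ∘ (inside ∷_)) ∎
  where
  open ≡-Reasoning
  j+k≡n = ℕₚ.suc-injective sj+sk≡sn

IncreasingFrom : ∀ {n k} → ℕ → Vec (Fin n) k → Set
IncreasingFrom b [] = ⊤
IncreasingFrom b (x ∷ xs) = b ≤ toℕ x × IncreasingFrom (suc (toℕ x)) xs

increasing-map-suc : ∀ {n k} b (xs : Vec (Fin n) k) → IncreasingFrom b xs → IncreasingFrom (suc b) (Vec.map suc xs)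
increasing-map-suc b [] _ = tt
increasing-map-suc b (x ∷ xs) (b≤x , rest) = s≤s b≤x , increasing-map-suc (suc (toℕ x)) xs rest

increasing-weaken : ∀ {n k b} (xs : Vec (Fin n) k) → IncreasingFrom (suc b) xs → IncreasingFrom b xs
increasing-weaken [] _ = tt
increasing-weaken (x ∷ xs) (b<x , rest) = ℕₚ.<⇒≤ b<x , rest

increasing-unsuc : ∀ {n k} b (xs : Vec (Fin (suc n)) k) → IncreasingFrom (suc b) xs →
  ∃ λ zs → xs ≡ Vec.map suc zs × IncreasingFrom b zs
increasing-unsuc b [] _ = [] , refl , tt
increasing-unsuc b (suc x ∷ xs) (s≤s b≤x , rest) with increasing-unsuc (suc (toℕ x)) xs rest
... | zs , refl , rest′ = x ∷ zs , refl , b≤x , rest′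

elements-increasing : ∀ {n} (p : Subset n) → IncreasingFrom 0 (proj₂ (elements p))
elements-increasing [] = tt
elements-increasing (outside ∷ p) =
  increasing-weaken (Vec.map suc (proj₂ (elements p))) (increasing-map-suc 0 _ (elements-increasing p))
elements-increasing (inside ∷ p) = z≤n , increasing-map-suc 0 _ (elements-increasing p)

elements-surjective : ∀ n k (xs : Vec (Fin n) k) → IncreasingFrom 0 xs → ∃ λ p → elements p ≡ (k , xs)
elements-surjective zero zero [] _ = [] , refl
elements-surjective (suc n) zero [] _ with elements-surjective n zero [] tt
... | p , eq = outside ∷ p , cong (λ (k , v) → k , Vec.map suc v) eq
elements-surjective (suc n) (suc k) (zero ∷ xs) (_ , rest) with increasing-unsuc 0 xs rest
... | zs , refl , rest′ with elements-surjective n k zs rest′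
... | p , eq = inside ∷ p , cong (λ (k , v) → suc k , zero ∷ Vec.map suc v) eq
elements-surjective (suc n) (suc k) xs@(suc _ ∷ _) (_ , rest) with increasing-unsuc 0 xs (s≤s z≤n , rest)
... | zs , xs≡suc-zs , rest′ with elements-surjective n (suc k) zs rest′
... | p , eq = outside ∷ p , trans (cong (λ (k , v) → k , Vec.map suc v) eq) (cong (suc k ,_) (sym xs≡suc-zs))

singleton-subset : ∀ {n} (i : Fin n) → ∃ λ p → elements p ≡ (1 , i ∷ [])
singleton-subset i = elements-surjective _ 1 (i ∷ []) (z≤n , tt)

pair-subset : ∀ {n} {i j : Fin n} → i < j → ∃ λ p → elements p ≡ (2 , i ∷ j ∷ [])
pair-subset i<j = elements-surjective _ 2 _ (z≤n , i<j , tt)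

triple-subset : ∀ {n} {i j l : Fin n} → i < j → j < l → ∃ λ p → elements p ≡ (3 , i ∷ j ∷ l ∷ [])
triple-subset i<j j<l = elements-surjective _ 3 _ (z≤n , i<j , j<l , tt)

singleton-shape : ∀ {n} (p : Subset n) → size p ≡ 1 → ∃ λ i → elements p ≡ (1 , i ∷ [])
singleton-shape p size≡1 with elements p
singleton-shape p refl | 1 , i ∷ [] = i , refl

pair-shape : ∀ {n} (p : Subset n) → size p ≡ 2 → ∃₂ λ i j → elements p ≡ (2 , i ∷ j ∷ []) × i < j
pair-shape p size≡2 with elements p | elements-increasing p
pair-shape p refl | 2 , i ∷ j ∷ [] | _ , i<j , _ = i , j , refl , i<j

triple-shape : ∀ {n} (p : Subset n) → size p ≡ 3 →
  ∃₂ λ i j → ∃ λ l → elements p ≡ (3 , i ∷ j ∷ l ∷ []) × i < j × j < l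
triple-shape p size≡3 with elements p | elements-increasing p
triple-shape p refl | 3 , i ∷ j ∷ l ∷ [] | _ , i<j , j<l , _ = i , j , l , refl , i<j , j<l

size-of : ∀ {n k} {p : Subset n} {xs : Vec (Fin n) k} → elements p ≡ (k , xs) → size p ≡ k
size-of = cong proj₁

elements-toList : ∀ {n k} {p q : Subset n} {xs ys : Vec (Fin n) k} →
  elements p ≡ (k , xs) → elements q ≡ (k , ys) → p ≡ q → Vec.toList xs ≡ Vec.toList ys
elements-toList eq₁ eq₂ refl = cong (Vec.toList ∘ proj₂) (trans (sym eq₁) eq₂)

singletons-distinct : ∀ {n} {p q : Subset n} {i j} →
  elements p ≡ (1 , i ∷ []) → elements q ≡ (1 , j ∷ []) → i ≢ j → p ≢ q
singletons-distinct eq₁ eq₂ i≢j p≡q = i≢j (proj₁ (∷-injective (elements-toList eq₁ eq₂ p≡q)))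

pairs-distinct : ∀ {n} {p q : Subset n} {i j i′ j′} →
  elements p ≡ (2 , i ∷ j ∷ []) → elements q ≡ (2 , i′ ∷ j′ ∷ []) → (i ≡ i′ → j ≢ j′) → p ≢ q
pairs-distinct eq₁ eq₂ different p≡q with ∷-injective (elements-toList eq₁ eq₂ p≡q)
... | i≡i′ , j∷[]≡j′∷[] = different i≡i′ (proj₁ (∷-injective j∷[]≡j′∷[]))

sumℕ : ∀ n → ℕ → (Subset n → ℕ) → ℕ
sumℕ = sumSubsets _+_ 0

sumℕ-congOn : ∀ n k {f g : Subset n → ℕ} → (∀ p → size p ≡ k → f p ≡ g p) → sumℕ n k f ≡ sumℕ n k g
sumℕ-congOn = sumSubsets-congOn

sumℕ-mono : ∀ n k {f g : Subset n → ℕ} → (∀ p → size p ≡ k → f p ≤ g p) → sumℕ n k f ≤ sumℕ n k g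
sumℕ-mono zero zero f≤g = f≤g [] refl
sumℕ-mono zero (suc k) f≤g = z≤n
sumℕ-mono (suc n) zero f≤g = sumℕ-mono n zero (f≤g ∘ (outside ∷_))
sumℕ-mono (suc n) (suc k) f≤g =
  ℕₚ.+-mono-≤ (sumℕ-mono n (suc k) (f≤g ∘ (outside ∷_))) (sumℕ-mono n k (λ p size≡k → f≤g (inside ∷ p) (cong suc size≡k)))

sumℕ-single : ∀ n k (f : Subset n → ℕ) p → size p ≡ k → f p ≤ sumℕ n k f
sumℕ-single zero zero f [] _ = ℕₚ.≤-refl
sumℕ-single (suc n) zero f (outside ∷ p) size≡0 = sumℕ-single n zero (f ∘ (outside ∷_)) p size≡0
sumℕ-single (suc n) (suc k) f (outside ∷ p) size≡k =
  ℕₚ.≤-trans (sumℕ-single n (suc k) (f ∘ (outside ∷_)) p size≡k) (ℕₚ.m≤m+n _ _)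
sumℕ-single (suc n) (suc k) f (inside ∷ p) size≡k =
  ℕₚ.≤-trans (sumℕ-single n k (f ∘ (inside ∷_)) p (ℕₚ.suc-injective size≡k)) (ℕₚ.m≤n+m _ _)

sumℕ-pair : ∀ n k (f : Subset n → ℕ) p q → p ≢ q → size p ≡ k → size q ≡ k → f p + f q ≤ sumℕ n k f
sumℕ-pair zero k f [] [] p≢q _ _ = ⊥-elim (p≢q refl)
sumℕ-pair (suc n) zero f (outside ∷ p) (outside ∷ q) p≢q size-p size-q =
  sumℕ-pair n zero (f ∘ (outside ∷_)) p q (p≢q ∘ cong (outside ∷_)) size-p size-q
sumℕ-pair (suc n) (suc k) f (outside ∷ p) (outside ∷ q) p≢q size-p size-q =
  ℕₚ.≤-trans (sumℕ-pair n (suc k) (f ∘ (outside ∷_)) p q (p≢q ∘ cong (outside ∷_)) size-p size-q) (ℕₚ.m≤m+n _ _)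
sumℕ-pair (suc n) (suc k) f (inside ∷ p) (inside ∷ q) p≢q size-p size-q =
  ℕₚ.≤-trans (sumℕ-pair n k (f ∘ (inside ∷_)) p q (p≢q ∘ cong (inside ∷_))
                        (ℕₚ.suc-injective size-p) (ℕₚ.suc-injective size-q)) (ℕₚ.m≤n+m _ _)
sumℕ-pair (suc n) (suc k) f (outside ∷ p) (inside ∷ q) p≢q size-p size-q =
  ℕₚ.+-mono-≤ (sumℕ-single n (suc k) (f ∘ (outside ∷_)) p size-p)
              (sumℕ-single n k (f ∘ (inside ∷_)) q (ℕₚ.suc-injective size-q))
sumℕ-pair (suc n) (suc k) f (inside ∷ p) (outside ∷ q) p≢q size-p size-q =
  subst (_≤ sumℕ (suc n) (suc k) f) (ℕₚ.+-comm (f (outside ∷ q)) (f (inside ∷ p)))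
    (ℕₚ.+-mono-≤ (sumℕ-single n (suc k) (f ∘ (outside ∷_)) q size-q)
                 (sumℕ-single n k (f ∘ (inside ∷_)) p (ℕₚ.suc-injective size-p)))

+-≤-≡-split : ∀ {a b c d} → a ≤ c → b ≤ d → a + b ≡ c + d → a ≡ c × b ≡ d
+-≤-≡-split {a} {b} {c} {d} a≤c b≤d a+b≡c+d with ℕₚ.m≤n⇒m<n∨m≡n a≤c
... | inj₂ refl = refl , ℕₚ.+-cancelˡ-≡ a b d a+b≡c+d
... | inj₁ a<c = ⊥-elim (ℕₚ.<⇒≱ (ℕₚ.+-mono-<-≤ a<c b≤d) (ℕₚ.≤-reflexive (sym a+b≡c+d)))

sumℕ-≡⇒≡ : ∀ n k {f g : Subset n → ℕ} → (∀ p → size p ≡ k → f p ≤ g p) → sumℕ n k f ≡ sumℕ n k g →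
  ∀ p → size p ≡ k → f p ≡ g p
sumℕ-≡⇒≡ zero zero f≤g sum≡ [] _ = sum≡
sumℕ-≡⇒≡ (suc n) zero f≤g sum≡ (outside ∷ p) = sumℕ-≡⇒≡ n zero (f≤g ∘ (outside ∷_)) sum≡ p
sumℕ-≡⇒≡ (suc n) zero f≤g sum≡ (inside ∷ p) ()
sumℕ-≡⇒≡ (suc n) (suc k) {f} {g} f≤g sum≡ = pointwise
  where
  halves = +-≤-≡-split (sumℕ-mono n (suc k) {f ∘ (outside ∷_)} {g ∘ (outside ∷_)} (f≤g ∘ (outside ∷_)))
                       (sumℕ-mono n k {f ∘ (inside ∷_)} {g ∘ (inside ∷_)} (λ p size≡k → f≤g (inside ∷ p) (cong suc size≡k)))
                       sum≡
  pointwise : ∀ p → size p ≡ suc k → f p ≡ g p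
  pointwise (outside ∷ p) size≡k = sumℕ-≡⇒≡ n (suc k) (f≤g ∘ (outside ∷_)) (proj₁ halves) p size≡k
  pointwise (inside ∷ p) size≡k =
    sumℕ-≡⇒≡ n k (λ p size≡k → f≤g (inside ∷ p) (cong suc size≡k)) (proj₂ halves) p (ℕₚ.suc-injective size≡k)

sumℕ-positive : ∀ n k (f : Subset n → ℕ) → 0 ℕ.< sumℕ n k f → ∃ λ p → size p ≡ k × 0 ℕ.< f p
sumℕ-positive zero zero f pos = [] , refl , pos
sumℕ-positive (suc n) zero f pos with sumℕ-positive n zero (f ∘ (outside ∷_)) pos
... | p , size≡0 , fp>0 = outside ∷ p , size≡0 , fp>0
sumℕ-positive (suc n) (suc k) f pos with 0 ℕ.<? sumℕ n (suc k) (f ∘ (outside ∷_))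
... | yes left>0 with sumℕ-positive n (suc k) (f ∘ (outside ∷_)) left>0
...   | p , size≡k , fp>0 = outside ∷ p , size≡k , fp>0
sumℕ-positive (suc n) (suc k) f pos | no left≯0 with sumℕ-positive n k (f ∘ (inside ∷_)) right>0
  where
  right>0 : 0 ℕ.< sumℕ n k (f ∘ (inside ∷_))
  right>0 = ℕₚ.<-≤-trans pos (ℕₚ.+-monoˡ-≤ (sumℕ n k (f ∘ (inside ∷_))) (ℕₚ.≮⇒≥ left≯0))
...   | p , size≡k , fp>0 = inside ∷ p , cong suc size≡k , fp>0

sumℕ-unique : ∀ n k (f : Subset n → ℕ) → sumℕ n k f ≡ 1 →
  ∃ λ p → size p ≡ k × f p ≡ 1 × (∀ q → size q ≡ k → q ≢ p → f q ≡ 0)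
sumℕ-unique n k f sum≡1 with sumℕ-positive n k f (subst (0 ℕ.<_) (sym sum≡1) (s≤s z≤n))
... | p , size-p , fp>0 = p , size-p , fp≡1 , others
  where
  fp≡1 : f p ≡ 1
  fp≡1 = ℕₚ.≤-antisym (subst (f p ≤_) sum≡1 (sumℕ-single n k f p size-p)) fp>0
  others : ∀ q → size q ≡ k → q ≢ p → f q ≡ 0
  others q size-q q≢p = ℕₚ.n≤0⇒n≡0 (ℕₚ.+-cancelˡ-≤ 1 (f q) 0
    (subst₂ _≤_ (cong (_+ f q) fp≡1) sum≡1 (sumℕ-pair n k f p q (q≢p ∘ sym) size-p size-q)))

sumℕ-const₀ : ∀ n (f : Subset n → ℕ) c → (∀ p → size p ≡ 0 → f p ≡ c) → sumℕ n 0 f ≡ c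
sumℕ-const₀ zero f c f≡c = f≡c [] refl
sumℕ-const₀ (suc n) f c f≡c = sumℕ-const₀ n (f ∘ (outside ∷_)) c (f≡c ∘ (outside ∷_))

sumℕ-const₁ : ∀ n (f : Subset n → ℕ) c → (∀ p → size p ≡ 1 → f p ≡ c) → sumℕ n 1 f ≡ n * c
sumℕ-const₁ zero f c f≡c = refl
sumℕ-const₁ (suc n) f c f≡c =
  trans (cong₂ _+_ (sumℕ-const₁ n (f ∘ (outside ∷_)) c (f≡c ∘ (outside ∷_)))
                   (sumℕ-const₀ n (f ∘ (inside ∷_)) c (λ p size≡0 → f≡c (inside ∷ p) (cong suc size≡0))))
        (ℕₚ.+-comm (n * c) c)

-- Coefficients of the characteristic polynomial

coeff-addP : ∀ p q k → coeff (addP p q) k ≡ coeff p k +ᵉ coeff q k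
coeff-addP [] q k = sym (+ᵉ-identityˡ (coeff q k))
coeff-addP (a ∷ p) [] k = sym (+ᵉ-identityʳ (coeff (a ∷ p) k))
coeff-addP (a ∷ p) (b ∷ q) zero = refl
coeff-addP (a ∷ p) (b ∷ q) (suc k) = coeff-addP p q k

coeff-scale : ∀ a q k → coeff (List.map (a *ᵉ_) q) k ≡ a *ᵉ coeff q k
coeff-scale a [] k = sym (*ᵉ-zeroʳ a)
coeff-scale a (b ∷ q) zero = refl
coeff-scale a (b ∷ q) (suc k) = coeff-scale a q k

coeff-negP : ∀ p k → coeff (negP p) k ≡ -ᵉ coeff p k
coeff-negP [] k = refl
coeff-negP (a ∷ p) zero = refl
coeff-negP (a ∷ p) (suc k) = coeff-negP p k

coeff-altSum : ∀ {m} (f : Fin m → Poly) k → coeff (altSum f) k ≡ altSumᵉ (λ j → coeff (f j) k)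
coeff-altSum {zero} f k = refl
coeff-altSum {suc m} f k = begin
  coeff (addP (f zero) (negP (altSum (f ∘ suc)))) k
    ≡⟨ coeff-addP (f zero) (negP (altSum (f ∘ suc))) k ⟩
  coeff (f zero) k +ᵉ coeff (negP (altSum (f ∘ suc))) k
    ≡⟨ cong (coeff (f zero) k +ᵉ_) (coeff-negP (altSum (f ∘ suc)) k) ⟩
  coeff (f zero) k +ᵉ -ᵉ coeff (altSum (f ∘ suc)) k
    ≡⟨ cong (λ x → coeff (f zero) k +ᵉ -ᵉ x) (coeff-altSum (f ∘ suc) k) ⟩
  altSumᵉ (λ j → coeff (f j) k) ∎
  where open ≡-Reasoning

xCoeff : ℤω → Poly → ℕ → ℤω
xCoeff e q zero = 0ᵉ
xCoeff e q (suc k) = e *ᵉ coeff q k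

-- p multiplies like the linear polynomial c + e x
IsLinear : Poly → ℤω → ℤω → Set
IsLinear p c e = ∀ q k → coeff (mulP p q) k ≡ c *ᵉ coeff q k +ᵉ xCoeff e q k

isLinear-constant : ∀ c → IsLinear (c ∷ []) c 0ᵉ
isLinear-constant c q zero =
  trans (coeff-addP (List.map (c *ᵉ_) q) (0ᵉ ∷ []) zero) (cong (_+ᵉ 0ᵉ) (coeff-scale c q zero))
isLinear-constant c q (suc k) =
  trans (coeff-addP (List.map (c *ᵉ_) q) (0ᵉ ∷ []) (suc k))
        (cong₂ _+ᵉ_ (coeff-scale c q (suc k)) (sym (*ᵉ-zeroˡ (coeff q k))))

xCoeff-zero : ∀ q k → xCoeff 0ᵉ q k ≡ 0ᵉ
xCoeff-zero q zero = refl
xCoeff-zero q (suc k) = *ᵉ-zeroˡ (coeff q k)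

isLinear-monic : ∀ c → IsLinear (c ∷ 1ᵉ ∷ []) c 1ᵉ
isLinear-monic c q zero =
  trans (coeff-addP (List.map (c *ᵉ_) q) (0ᵉ ∷ mulP (1ᵉ ∷ []) q) zero) (cong (_+ᵉ 0ᵉ) (coeff-scale c q zero))
isLinear-monic c q (suc k) =
  trans (coeff-addP (List.map (c *ᵉ_) q) (0ᵉ ∷ mulP (1ᵉ ∷ []) q) (suc k))
        (cong₂ _+ᵉ_ (coeff-scale c q (suc k)) timesOne)
  where
  timesOne : coeff (mulP (1ᵉ ∷ []) q) k ≡ 1ᵉ *ᵉ coeff q k
  timesOne = begin
    coeff (mulP (1ᵉ ∷ []) q) k            ≡⟨ isLinear-constant 1ᵉ q k ⟩
    1ᵉ *ᵉ coeff q k +ᵉ xCoeff 0ᵉ q k      ≡⟨ cong (1ᵉ *ᵉ coeff q k +ᵉ_) (xCoeff-zero q k) ⟩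
    1ᵉ *ᵉ coeff q k +ᵉ 0ᵉ                 ≡⟨ +ᵉ-identityʳ (1ᵉ *ᵉ coeff q k) ⟩
    1ᵉ *ᵉ coeff q k                       ∎
    where open ≡-Reasoning

-- Expanding along row 0, the x-coefficients of k rows are chosen from E and the rest from C.
coeff-det : ∀ n (M : Fin n → Fin n → Poly) (C E : Matrix n) → (∀ r c → IsLinear (M r c) (C r c) (E r c)) →
  ∀ k → coeff (det n M) k ≡ sumᵉ n k (λ q → detᵉ n (mixRows q E C))
coeff-det zero M C E linear zero = refl
coeff-det zero M C E linear (suc k) = refl
coeff-det (suc n) M C E linear k = begin
  coeff (det (suc n) M) k
    ≡⟨ coeff-altSum (λ j → mulP (M zero j) (det n (Mⱼ j))) k ⟩
  altSumᵉ (λ j → coeff (mulP (M zero j) (det n (Mⱼ j))) k)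
    ≡⟨ altSumᵉ-cong (λ j → linear zero j (det n (Mⱼ j)) k) ⟩
  altSumᵉ (λ j → C zero j *ᵉ coeff (det n (Mⱼ j)) k +ᵉ xCoeff (E zero j) (det n (Mⱼ j)) k)
    ≡⟨ altSumᵉ-+ (λ j → C zero j *ᵉ coeff (det n (Mⱼ j)) k) (λ j → xCoeff (E zero j) (det n (Mⱼ j)) k) ⟩
  altSumᵉ (λ j → C zero j *ᵉ coeff (det n (Mⱼ j)) k) +ᵉ altSumᵉ (λ j → xCoeff (E zero j) (det n (Mⱼ j)) k)
    ≡⟨ cong₂ _+ᵉ_ (expandRow0 C k) (xPart k) ⟩
  sumᵉ n k (λ q → detᵉ (suc n) (mixRows (outside ∷ q) E C)) +ᵉ xSum k
    ≡⟨ combine k ⟩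
  sumᵉ (suc n) k (λ q → detᵉ (suc n) (mixRows q E C)) ∎
  where
  open ≡-Reasoning
  Mⱼ : Fin (suc n) → Fin n → Fin n → Poly
  Mⱼ j r c = M (suc r) (punchIn j c)
  Y : Fin (suc n) → Subset n → ℤω
  Y j q = detᵉ n (mixRows q (minor zero j E) (minor zero j C))
  expandRow0 : ∀ (R : Matrix (suc n)) k →
    altSumᵉ (λ j → R zero j *ᵉ coeff (det n (Mⱼ j)) k) ≡ sumᵉ n k (λ q → altSumᵉ (λ j → R zero j *ᵉ Y j q))
  expandRow0 R k = begin
    altSumᵉ (λ j → R zero j *ᵉ coeff (det n (Mⱼ j)) k)
      ≡⟨ altSumᵉ-cong (λ j → cong (R zero j *ᵉ_)
           (coeff-det n (Mⱼ j) (minor zero j C) (minor zero j E) (λ r c → linear (suc r) (punchIn j c)) k)) ⟩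
    altSumᵉ (λ j → R zero j *ᵉ sumᵉ n k (Y j))
      ≡⟨ sumᵉ-altSumᵉ n k (R zero) Y ⟨
    sumᵉ n k (λ q → altSumᵉ (λ j → R zero j *ᵉ Y j q)) ∎
  xSum : ℕ → ℤω
  xSum zero = 0ᵉ
  xSum (suc k) = sumᵉ n k (λ q → detᵉ (suc n) (mixRows (inside ∷ q) E C))
  xPart : ∀ k → altSumᵉ (λ j → xCoeff (E zero j) (det n (Mⱼ j)) k) ≡ xSum k
  xPart zero = altSumᵉ-zero (suc n)
  xPart (suc k) = expandRow0 E k
  combine : ∀ k → sumᵉ n k (λ q → detᵉ (suc n) (mixRows (outside ∷ q) E C)) +ᵉ xSum k
                ≡ sumᵉ (suc n) k (λ q → detᵉ (suc n) (mixRows q E C))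
  combine zero = +ᵉ-identityʳ (sumᵉ n zero (λ q → detᵉ (suc n) (mixRows (outside ∷ q) E C)))
  combine (suc k) = refl

negᴹ : ∀ {n} → Matrix n → Matrix n
negᴹ A i j = -ᵉ A i j

charPoly-entry-isLinear : ∀ {n} (A : Matrix n) i j →
  IsLinear (if does (i ≟ j) then (-ᵉ A i j) ∷ 1ᵉ ∷ [] else (-ᵉ A i j) ∷ []) (-ᵉ A i j) (δ i j)
charPoly-entry-isLinear A i j with does (i ≟ j)
... | true = isLinear-monic (-ᵉ A i j)
... | false = isLinear-constant (-ᵉ A i j)

mixRows-∁ : ∀ {n} (q : Subset n) M N r c → mixRows (∁ q) M N r c ≡ mixRows q N M r c
mixRows-∁ q M N r c rewrite lookup-map r not q with lookup q r
... | true = refl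
... | false = refl

coeff-charPoly : ∀ n (A : Matrix n) k → coeff (charPoly A) k ≡ sumᵉ n k (λ q → principalMinor (∁ q) (negᴹ A))
coeff-charPoly n A k =
  trans (coeff-det n _ (negᴹ A) δ (charPoly-entry-isLinear A) k)
        (sumSubsets-congOn n k (λ q _ → trans (detᵉ-cong n (λ r c → sym (mixRows-∁ q (negᴹ A) δ r c)))
                                              (detᵉ-mixRows-δ n (∁ q) (negᴹ A))))

principalMinorSum : ∀ {n} → ℕ → Matrix n → ℤω
principalMinorSum {n} k A = sumᵉ n k (λ p → principalMinor p (negᴹ A))

coeff-charPoly-minors : ∀ n (A : Matrix n) j k → j + k ≡ n → coeff (charPoly A) j ≡ principalMinorSum k A
coeff-charPoly-minors n A j k j+k≡n =
  trans (coeff-charPoly n A j) (sumᵉ-∁ n j k (λ p → principalMinor p (negᴹ A)) j+k≡n)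

principalMinor-outside : ∀ {n} (p : Subset n) M → principalMinor (outside ∷ p) M ≡ principalMinor p (minor zero zero M)
principalMinor-outside p M = detᵉ-cong (size p) (λ a b → cong₂ M (lookup-map a suc v) (lookup-map b suc v))
  where v = proj₂ (elements p)

sumᵉ-principalMinor-empty : ∀ n (M : Matrix n) → sumᵉ n 0 (λ p → principalMinor p M) ≡ 1ᵉ
sumᵉ-principalMinor-empty zero M = refl
sumᵉ-principalMinor-empty (suc n) M =
  trans (sumSubsets-congOn n 0 (λ p _ → principalMinor-outside p M)) (sumᵉ-principalMinor-empty n (minor zero zero M))

coeff-charPoly-top : ∀ n (A : Matrix n) → coeff (charPoly A) n ≡ 1ᵉ
coeff-charPoly-top n A =
  trans (coeff-charPoly-minors n A n 0 (ℕₚ.+-identityʳ n)) (sumᵉ-principalMinor-empty n (negᴹ A))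

coeff-charPoly-above : ∀ n (A : Matrix n) j → n ℕ.< j → coeff (charPoly A) j ≡ 0ᵉ
coeff-charPoly-above n A j n<j =
  trans (coeff-charPoly n A j) (sumSubsets-oversized refl n j (λ q → principalMinor (∁ q) (negᴹ A)) n<j)

-- Gains on the complete graph, triangles and switching

record Gains (n : ℕ) : Set where
  field
    φ      : Fin n → Fin n → T6
    φ-anti : ∀ i j → φ j i ≡ ⊖ φ i j
    φ-diag : ∀ i → φ i i ≡ zero
open Gains public

triangle : ∀ {n} → Gains n → Fin n → Fin n → Fin n → T6
triangle G i j l = φ G i j ⊕ φ G j l ⊕ φ G l i

switching : ∀ {n} → (Fin n → T6) → Gains n → Gains n
switching y G = record
  { φ      = λ i j → y i ⊕ φ G i j ⊕ ⊖ y j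
  ; φ-anti = λ i j → trans (cong (λ g → y j ⊕ g ⊕ ⊖ y i) (φ-anti G i j)) (⊖-conjugate (y i) (φ G i j) (y j))
  ; φ-diag = λ i → trans (cong (λ g → y i ⊕ g ⊕ ⊖ y i) (φ-diag G i)) (⊕-zero-⊖ (y i))
  }

deleteZero : ∀ {n} → Gains (suc n) → Gains n
deleteZero G = record
  { φ = λ i j → φ G (suc i) (suc j) ; φ-anti = λ i j → φ-anti G (suc i) (suc j) ; φ-diag = φ-diag G ∘ suc }

module _ {n} (G : Gains n) where

  triangle-switching : ∀ y i j l → triangle (switching y G) i j l ≡ triangle G i j l
  triangle-switching y i j l = conjugates-telescope (y i) (y j) (y l) (φ G i j) (φ G j l) (φ G l i)

  switching-by-row : ∀ w i j → φ (switching (φ G w) G) i j ≡ triangle G w i j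
  switching-by-row w i j = cong (φ G w i ⊕ φ G i j ⊕_) (sym (φ-anti G w j))

  switching-⊕ : ∀ (y z : Fin n → T6) i j → φ (switching (λ k → y k ⊕ z k) G) i j ≡ (z i ⊕ ⊖ z j) ⊕ φ (switching y G) i j
  switching-⊕ y z i j = ⊕-⊖-regroup (y i) (z i) (φ G i j) (y j) (z j)

  triangle-cocycle : ∀ w x y z → triangle G x y z ≡ triangle G w x y ⊕ triangle G w y z ⊕ triangle G w z x
  triangle-cocycle w x y z = begin
    triangle G x y z                                   ≡⟨ triangle-switching (φ G w) x y z ⟨
    triangle (switching (φ G w) G) x y z                  ≡⟨ cong₂ _⊕_ (cong₂ _⊕_ (switching-by-row w x y) (switching-by-row w y z))
                                                                    (switching-by-row w z x) ⟩
    triangle G w x y ⊕ triangle G w y z ⊕ triangle G w z x ∎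
    where open ≡-Reasoning

  triangle-rotate : ∀ i j l → triangle G i j l ≡ triangle G j l i
  triangle-rotate i j l = ⊕-rotate₃ (φ G i j) (φ G j l) (φ G l i)

  triangle-swap : ∀ i j l → triangle G j i l ≡ ⊖ triangle G i j l
  triangle-swap i j l rewrite φ-anti G i j | φ-anti G l i | φ-anti G j l =
    ⊖-reverse₃ (φ G i j) (φ G j l) (φ G l i)

  triangle-swap₂₃ : ∀ i j l → triangle G i l j ≡ ⊖ triangle G i j l
  triangle-swap₂₃ i j l = begin
    triangle G i l j       ≡⟨ triangle-rotate i l j ⟩
    triangle G l j i       ≡⟨ triangle-swap j l i ⟩
    ⊖ triangle G j l i     ≡⟨ cong ⊖_ (triangle-rotate i j l) ⟨
    ⊖ triangle G i j l     ∎
    where open ≡-Reasoning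

  triangle-degenerate : ∀ i l → triangle G i i l ≡ zero
  triangle-degenerate i l rewrite φ-diag G i | φ-anti G i l = zero-⊕-⊖ (φ G i l)

  triangle-degenerate′ : ∀ i l → triangle G i l i ≡ zero
  triangle-degenerate′ i l = trans (sym (triangle-rotate i i l)) (triangle-degenerate i l)

module _ {n} (P : Fin n → Fin n → Fin n → Set)
  (rotate : ∀ i j l → P i j l → P j l i) (swap : ∀ i j l → P i j l → P j i l)
  (degenerate : ∀ i l → P i i l) (sorted : ∀ i j l → i < j → j < l → P i j l) where

  allTriples : ∀ i j l → P i j l
  allTriples i j l with <-cmp i j
  ... | tri≈ _ refl _ = degenerate i l
  ... | tri< i<j _ _ with <-cmp j l
  ...   | tri< j<l _ _ = sorted i j l i<j j<l
  ...   | tri≈ _ refl _ = rotate j i j (rotate j j i (degenerate j i))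
  ...   | tri> _ _ l<j with <-cmp i l
  ...     | tri< i<l _ _ = rotate l i j (swap i l j (sorted i l j i<l l<j))
  ...     | tri≈ _ refl _ = rotate i i j (degenerate i j)
  ...     | tri> _ _ l<i = rotate l i j (sorted l i j l<i i<j)
  allTriples i j l | tri> _ _ j<i with <-cmp i l
  ...   | tri< i<l _ _ = swap j i l (sorted j i l j<i i<l)
  ...   | tri≈ _ refl _ = rotate i i j (degenerate i j)
  ...   | tri> _ _ l<i with <-cmp j l
  ...     | tri< j<l _ _ = rotate l i j (rotate j l i (sorted j l i j<l l<i))
  ...     | tri≈ _ refl _ = rotate j i j (rotate j j i (degenerate j i))
  ...     | tri> _ _ l<j = rotate l i j (rotate j l i (swap l j i (sorted l j i l<j j<i)))

-- Defect sums

tripleDefect : ∀ {n} → Gains n → Σ ℕ (Vec (Fin n)) → ℕ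
tripleDefect G (3 , i ∷ j ∷ l ∷ []) = defect (triangle G i j l)
tripleDefect G _ = 0

totalDefect : ∀ {n} → Gains n → ℕ
totalDefect {n} G = sumℕ n 3 (tripleDefect G ∘ elements)

starPairDefect : ∀ {n} → Gains (suc n) → Σ ℕ (Vec (Fin n)) → ℕ
starPairDefect G (2 , i ∷ j ∷ []) = defect (triangle G zero (suc i) (suc j))
starPairDefect G _ = 0

starDefect : ∀ {n} → Gains (suc n) → ℕ
starDefect {n} G = sumℕ n 2 (starPairDefect G ∘ elements)

pairDefect : ∀ {m} → (Fin m → T6) → Σ ℕ (Vec (Fin m)) → ℕ
pairDefect κ (2 , i ∷ j ∷ []) = defect (κ i ⊕ ⊖ κ j)
pairDefect κ _ = 0

spread : ∀ {m} → (Fin m → T6) → ℕ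
spread {m} κ = sumℕ m 2 (pairDefect κ ∘ elements)

pointDefect : ∀ {m} → (Fin (suc m) → T6) → Σ ℕ (Vec (Fin m)) → ℕ
pointDefect κ (1 , j ∷ []) = defect (κ zero ⊕ ⊖ κ (suc j))
pointDefect κ _ = 0

spreadFromZero : ∀ {m} → (Fin (suc m) → T6) → ℕ
spreadFromZero {m} κ = sumℕ m 1 (pointDefect κ ∘ elements)

totalDefect-split : ∀ {n} (G : Gains (suc n)) → totalDefect G ≡ totalDefect (deleteZero G) + starDefect G
totalDefect-split {n} G = cong₂ _+_ (sumℕ-congOn n 3 avoidingZero) (sumℕ-congOn n 2 throughZero)
  where
  avoidingZero : ∀ p → size p ≡ 3 → tripleDefect G (elements (outside ∷ p)) ≡ tripleDefect (deleteZero G) (elements p)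
  avoidingZero p size≡3 with triple-shape p size≡3
  ... | _ , _ , _ , eq , _ rewrite eq = refl
  throughZero : ∀ p → size p ≡ 2 → tripleDefect G (elements (inside ∷ p)) ≡ starPairDefect G (elements p)
  throughZero p size≡2 with pair-shape p size≡2
  ... | _ , _ , eq , _ rewrite eq = refl

spread-split : ∀ {m} (κ : Fin (suc m) → T6) → spread κ ≡ spread (κ ∘ suc) + spreadFromZero κ
spread-split {m} κ = cong₂ _+_ (sumℕ-congOn m 2 avoidingZero) (sumℕ-congOn m 1 throughZero)
  where
  avoidingZero : ∀ p → size p ≡ 2 → pairDefect κ (elements (outside ∷ p)) ≡ pairDefect (κ ∘ suc) (elements p)
  avoidingZero p size≡2 with pair-shape p size≡2
  ... | _ , _ , eq , _ rewrite eq = refl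
  throughZero : ∀ p → size p ≡ 1 → pairDefect κ (elements (inside ∷ p)) ≡ pointDefect κ (elements p)
  throughZero p size≡1 with singleton-shape p size≡1
  ... | _ , eq rewrite eq = refl

triangle-defect-≤ : ∀ {n} (G : Gains n) {i j l} → i < j → j < l → defect (triangle G i j l) ≤ totalDefect G
triangle-defect-≤ G i<j j<l with triple-subset i<j j<l
... | p , eq = subst (_≤ totalDefect G) (cong (tripleDefect G) eq) (sumℕ-single _ 3 _ p (size-of eq))

star-defect-≤ : ∀ {n} (G : Gains (suc n)) {i j} → i < j → defect (triangle G zero (suc i) (suc j)) ≤ starDefect G
star-defect-≤ G i<j with pair-subset i<j
... | p , eq = subst (_≤ starDefect G) (cong (starPairDefect G) eq) (sumℕ-single _ 2 _ p (size-of eq))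

pair-defect-≤ : ∀ {m} (κ : Fin m → T6) {i j} → i < j → defect (κ i ⊕ ⊖ κ j) ≤ spread κ
pair-defect-≤ κ i<j with pair-subset i<j
... | p , eq = subst (_≤ spread κ) (cong (pairDefect κ) eq) (sumℕ-single _ 2 _ p (size-of eq))

point-defect-≤ : ∀ {m} (κ : Fin (suc m) → T6) j → defect (κ zero ⊕ ⊖ κ (suc j)) ≤ spreadFromZero κ
point-defect-≤ κ j with singleton-subset j
... | p , eq = subst (_≤ spreadFromZero κ) (cong (pointDefect κ) eq) (sumℕ-single _ 1 _ p (size-of eq))

defect≤0⇒≡zero : ∀ {t} → defect t ≤ 0 → t ≡ zero
defect≤0⇒≡zero {t} = defect≡0⇒≡zero t ∘ ℕₚ.n≤0⇒n≡0

totalDefect-trivial : ∀ {n} (G : Gains n) → (∀ i j → φ G i j ≡ zero) → totalDefect G ≡ 0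
totalDefect-trivial {n} G trivial = trans (sumℕ-congOn n 3 vanish) (sumSubsets-ε refl n 3)
  where
  vanish : ∀ p → size p ≡ 3 → tripleDefect G (elements p) ≡ 0
  vanish p size≡3 with triple-shape p size≡3
  ... | i , j , l , eq , _ rewrite eq | trivial i j | trivial j l | trivial l i = refl

totalDefect≡0⇒balanced : ∀ {n} (G : Gains n) → totalDefect G ≡ 0 → ∀ i j l → triangle G i j l ≡ zero
totalDefect≡0⇒balanced G total≡0 = allTriples (λ i j l → triangle G i j l ≡ zero)
  (λ i j l t≡0 → trans (sym (triangle-rotate G i j l)) t≡0)
  (λ i j l t≡0 → trans (triangle-swap G i j l) (cong ⊖_ t≡0))
  (triangle-degenerate G)
  (λ i j l i<j j<l → defect≤0⇒≡zero (subst (defect (triangle G i j l) ≤_) total≡0 (triangle-defect-≤ G i<j j<l)))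

spread≡0⇒constant : ∀ {m} (κ : Fin m → T6) → spread κ ≡ 0 → ∀ i j → κ i ≡ κ j
spread≡0⇒constant κ spread≡0 i j = byOrder (<-cmp i j)
  where
  ordered : ∀ {i j} → i < j → κ i ≡ κ j
  ordered i<j = ⊕-⊖-cancel _ _ (defect≤0⇒≡zero (subst (_ ≤_) spread≡0 (pair-defect-≤ κ i<j)))
  byOrder : Tri (i < j) (i ≡ j) (j < i) → κ i ≡ κ j
  byOrder (tri< i<j _ _) = ordered i<j
  byOrder (tri≈ _ i≡j _) = cong κ i≡j
  byOrder (tri> _ _ j<i) = sym (ordered j<i)

starDefect-positive : ∀ {n} (G : Gains (suc n)) → 0 ℕ.< totalDefect (deleteZero G) → 0 ℕ.< starDefect G
starDefect-positive {n} G rest>0 with sumℕ-positive n 3 _ rest>0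
... | p , size≡3 , tp>0 with triple-shape p size≡3
... | i , j , l , eq , i<j , j<l = throughZero
  where
  open ≡-Reasoning
  t≢0 : triangle G (suc i) (suc j) (suc l) ≢ zero
  t≢0 t≡0 = ℕₚ.<-irrefl refl (subst (0 ℕ.<_) (trans (cong (tripleDefect (deleteZero G)) eq) (cong defect t≡0)) tp>0)
  star : ∀ {a b} → a < b → triangle G zero (suc a) (suc b) ≢ zero → 0 ℕ.< starDefect G
  star a<b t≢0 = ℕₚ.<-≤-trans (defect-positive _ t≢0) (star-defect-≤ G a<b)
  throughZero : 0 ℕ.< starDefect G
  throughZero with triangle G zero (suc i) (suc j) ≟ zero | triangle G zero (suc j) (suc l) ≟ zero
                 | triangle G zero (suc i) (suc l) ≟ zero
  ... | no ≢0 | _ | _ = star i<j ≢0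
  ... | yes _ | no ≢0 | _ = star j<l ≢0
  ... | yes _ | yes _ | no ≢0 = star (ℕₚ.<-trans i<j j<l) ≢0
  ... | yes ij≡0 | yes jl≡0 | yes il≡0 = ⊥-elim (t≢0 (begin
    triangle G (suc i) (suc j) (suc l)
      ≡⟨ triangle-cocycle G zero (suc i) (suc j) (suc l) ⟩
    triangle G zero (suc i) (suc j) ⊕ triangle G zero (suc j) (suc l) ⊕ triangle G zero (suc l) (suc i)
      ≡⟨ cong₂ _⊕_ (cong₂ _⊕_ ij≡0 jl≡0) (trans (triangle-swap₂₃ G zero (suc i) (suc l)) (cong ⊖_ il≡0)) ⟩
    zero ∎))

potential : ∀ {n} → Gains (suc (suc n)) → Fin (suc n) → T6
potential G i = triangle G (suc zero) zero (suc i)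

triangle-potential : ∀ {n} (G : Gains (suc (suc n))) → (∀ i j l → triangle (deleteZero G) i j l ≡ zero) →
  ∀ i j → triangle G zero (suc i) (suc j) ≡ potential G i ⊕ ⊖ potential G j
triangle-potential G balanced i j = begin
  triangle G zero (suc i) (suc j)
    ≡⟨ triangle-cocycle G (suc zero) zero (suc i) (suc j) ⟩
  potential G i ⊕ triangle G (suc zero) (suc i) (suc j) ⊕ triangle G (suc zero) (suc j) zero
    ≡⟨ cong₂ (λ a b → potential G i ⊕ a ⊕ b) (balanced zero i j) (triangle-swap₂₃ G (suc zero) zero (suc j)) ⟩
  potential G i ⊕ zero ⊕ ⊖ potential G j
    ≡⟨ ⊕-zero-middle (potential G i) (potential G j) ⟩
  potential G i ⊕ ⊖ potential G j ∎
  where open ≡-Reasoning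

starDefect≡spread : ∀ {n} (G : Gains (suc (suc n))) → (∀ i j l → triangle (deleteZero G) i j l ≡ zero) →
  starDefect G ≡ spread (potential G)
starDefect≡spread {n} G balanced = sumℕ-congOn (suc n) 2 byPotential
  where
  byPotential : ∀ p → size p ≡ 2 → starPairDefect G (elements p) ≡ pairDefect (potential G) (elements p)
  byPotential p size≡2 with pair-shape p size≡2
  ... | i , j , eq , _ rewrite eq = cong defect (triangle-potential G balanced i j)

spreadFromZero-const : ∀ {m} (κ : Fin (suc m) → T6) c → (∀ i → κ (suc i) ≡ c) →
  spreadFromZero κ ≡ m * defect (κ zero ⊕ ⊖ c)
spreadFromZero-const {m} κ c κ≡c = sumℕ-const₁ m _ _ constant
  where
  constant : ∀ p → size p ≡ 1 → pointDefect κ (elements p) ≡ defect (κ zero ⊕ ⊖ c)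
  constant p size≡1 with singleton-shape p size≡1
  ... | j , eq rewrite eq = cong (λ x → defect (κ zero ⊕ ⊖ x)) (κ≡c j)

spread-constant : ∀ {m} (κ : Fin m → T6) c → (∀ i → κ i ≡ c) → spread κ ≡ 0
spread-constant {m} κ c κ≡c = trans (sumℕ-congOn m 2 vanish) (sumSubsets-ε refl m 2)
  where
  vanish : ∀ p → size p ≡ 2 → pairDefect κ (elements p) ≡ 0
  vanish p size≡2 with pair-shape p size≡2
  ... | i , j , eq , _ rewrite eq | κ≡c i | κ≡c j = cong defect (⊕-inverseʳ c)

spreadFromZero-positive : ∀ {m} (κ : Fin (suc m) → T6) → 0 ℕ.< spread (κ ∘ suc) → 0 ℕ.< spreadFromZero κ
spreadFromZero-positive {m} κ rest>0 with sumℕ-positive m 2 _ rest>0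
... | p , size≡2 , dp>0 with pair-shape p size≡2
... | i , j , eq , _ with κ zero ≟ κ (suc i)
...   | yes κ₀≡κᵢ = differsFrom j (λ κ₀≡κⱼ → κᵢ≢κⱼ (trans (sym κ₀≡κᵢ) κ₀≡κⱼ))
  where
  κᵢ≢κⱼ : κ (suc i) ≢ κ (suc j)
  κᵢ≢κⱼ κᵢ≡κⱼ = ℕₚ.<-irrefl refl (subst (0 ℕ.<_) (trans (cong (pairDefect (κ ∘ suc)) eq)
                                                         (cong defect (trans (cong (_⊕ ⊖ κ (suc j)) κᵢ≡κⱼ) (⊕-inverseʳ (κ (suc j)))))) dp>0)
  differsFrom : ∀ j → κ zero ≢ κ (suc j) → 0 ℕ.< spreadFromZero κ
  differsFrom j ≢ = ℕₚ.<-≤-trans (defect-positive _ (≢ ∘ ⊕-⊖-cancel _ _)) (point-defect-≤ κ j)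
...   | no κ₀≢κᵢ = ℕₚ.<-≤-trans (defect-positive _ (κ₀≢κᵢ ∘ ⊕-⊖-cancel _ _)) (point-defect-≤ κ i)

spreadFromZero≡1 : ∀ {m} (κ : Fin (suc m) → T6) → spreadFromZero κ ≡ 1 →
  ∃ λ j₀ → defect (κ zero ⊕ ⊖ κ (suc j₀)) ≡ 1 × (∀ j → j ≢ j₀ → κ (suc j) ≡ κ zero)
spreadFromZero≡1 {m} κ sum≡1 with sumℕ-unique m 1 _ sum≡1
... | p , size-p , dp≡1 , others with singleton-shape p size-p
... | j₀ , eq = j₀ , trans (sym (cong (pointDefect κ) eq)) dp≡1 , agree
  where
  agree : ∀ j → j ≢ j₀ → κ (suc j) ≡ κ zero
  agree j j≢j₀ with singleton-subset j
  ... | q , eq-q = sym (⊕-⊖-cancel _ _ (defect≡0⇒≡zero _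
          (trans (sym (cong (pointDefect κ) eq-q)) (others q (size-of eq-q) (singletons-distinct eq-q eq j≢j₀)))))

starDefect≡1 : ∀ {n} (G : Gains (suc n)) → starDefect G ≡ 1 →
  ∃₂ λ a b → defect (triangle G zero (suc a) (suc b)) ≡ 1 ×
             (∀ i j → i < j → (i ≡ a → j ≢ b) → triangle G zero (suc i) (suc j) ≡ zero)
starDefect≡1 {n} G sum≡1 with sumℕ-unique n 2 _ sum≡1
... | p , size-p , dp≡1 , others with pair-shape p size-p
... | a , b , eq , _ = a , b , trans (sym (cong (starPairDefect G) eq)) dp≡1 , vanish
  where
  vanish : ∀ i j → i < j → (i ≡ a → j ≢ b) → triangle G zero (suc i) (suc j) ≡ zero
  vanish i j i<j not-ab with pair-subset i<j
  ... | q , eq-q = defect≡0⇒≡zero _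
          (trans (sym (cong (starPairDefect G) eq-q)) (others q (size-of eq-q) (pairs-distinct eq-q eq not-ab)))

spread-lowerBound : ∀ {m} (κ : Fin (suc m) → T6) → spread κ ≡ 0 ⊎ m ≤ spread κ
spread-lowerBound {zero} κ = inj₁ refl
spread-lowerBound {suc m} κ with spread (κ ∘ suc) ℕ.≟ 0 | spread-lowerBound (κ ∘ suc)
... | yes rest≡0 | _ = subst (λ s → s ≡ 0 ⊎ suc m ≤ s) (sym total) (zeroOrLarge d)
  where
  d = defect (κ zero ⊕ ⊖ κ (suc zero))
  total : spread κ ≡ suc m * d
  total = trans (spread-split κ)
                (cong₂ _+_ rest≡0 (spreadFromZero-const κ (κ (suc zero)) (λ i → spread≡0⇒constant (κ ∘ suc) rest≡0 i zero)))
  zeroOrLarge : ∀ d → suc m * d ≡ 0 ⊎ suc m ≤ suc m * d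
  zeroOrLarge zero = inj₁ (ℕₚ.*-zeroʳ (suc m))
  zeroOrLarge (suc d) = inj₂ (ℕₚ.m≤m*n (suc m) (suc d))
... | no rest≢0 | inj₁ rest≡0 = ⊥-elim (rest≢0 rest≡0)
... | no rest≢0 | inj₂ m≤rest = inj₂ (subst₂ _≤_ (ℕₚ.+-comm m 1) (sym (spread-split κ))
  (ℕₚ.+-mono-≤ m≤rest (spreadFromZero-positive κ (ℕₚ.n≢0⇒n>0 rest≢0))))

spread-extremal : ∀ {m} (κ : Fin (suc (suc m)) → T6) → spread κ ≡ suc m →
  ∃₂ λ p c → defect (κ p ⊕ ⊖ c) ≡ 1 × (∀ i → i ≢ p → κ i ≡ c)
spread-extremal {m} κ spread≡ with spread (κ ∘ suc) ℕ.≟ 0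
... | yes rest≡0 = zero , κ (suc zero) , defect≡1 , others
  where
  open ≡-Reasoning
  d = defect (κ zero ⊕ ⊖ κ (suc zero))
  constant : ∀ i → κ (suc i) ≡ κ (suc zero)
  constant i = spread≡0⇒constant (κ ∘ suc) rest≡0 i zero
  defect≡1 : d ≡ 1
  defect≡1 = ℕₚ.*-cancelˡ-≡ d 1 (suc m) (begin
    suc m * d                              ≡⟨ spreadFromZero-const κ (κ (suc zero)) constant ⟨
    spreadFromZero κ                       ≡⟨ cong (_+ spreadFromZero κ) rest≡0 ⟨
    spread (κ ∘ suc) + spreadFromZero κ    ≡⟨ spread-split κ ⟨
    spread κ                               ≡⟨ spread≡ ⟩
    suc m                                  ≡⟨ ℕₚ.*-identityʳ (suc m) ⟨
    suc m * 1                              ∎)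
  others : ∀ i → i ≢ zero → κ i ≡ κ (suc zero)
  others zero 0≢0 = ⊥-elim (0≢0 refl)
  others (suc i) _ = constant i
spread-extremal {zero} κ spread≡ | no rest≢0 = ⊥-elim (rest≢0 refl)
spread-extremal {suc m} κ spread≡ | no rest≢0 with spread-lowerBound (κ ∘ suc)
... | inj₁ rest≡0 = ⊥-elim (rest≢0 rest≡0)
... | inj₂ m≤rest with spreadFromZero≡1 κ (sym (proj₂ (+-≤-≡-split m≤rest fromZero>0 split)))
  where
  fromZero>0 = spreadFromZero-positive κ (ℕₚ.n≢0⇒n>0 rest≢0)
  split = trans (ℕₚ.+-comm (suc m) 1) (trans (sym spread≡) (spread-split κ))
... | j₀ , defect≡1 , agree = suc j₀ , κ zero , defect≡1′ , others
  where
  defect≡1′ : defect (κ (suc j₀) ⊕ ⊖ κ zero) ≡ 1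
  defect≡1′ = trans (cong defect (sym (⊖-difference (κ zero) (κ (suc j₀))))) (trans (defect-⊖ _) defect≡1)
  others : ∀ i → i ≢ suc j₀ → κ i ≡ κ zero
  others zero _ = refl
  others (suc j) j≢j₀ = agree j (j≢j₀ ∘ cong suc)

totalDefect-lowerBound : ∀ {n} (G : Gains (suc (suc n))) → totalDefect G ≡ 0 ⊎ n ≤ totalDefect G
totalDefect-lowerBound {zero} G = inj₂ z≤n
totalDefect-lowerBound {suc n} G with totalDefect (deleteZero G) ℕ.≟ 0 | totalDefect-lowerBound (deleteZero G)
... | yes rest≡0 | _ = subst (λ t → t ≡ 0 ⊎ suc n ≤ t) (sym total≡spread) (spread-lowerBound (potential G))
  where
  total≡spread : totalDefect G ≡ spread (potential G)
  total≡spread = trans (totalDefect-split G)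
    (cong₂ _+_ rest≡0 (starDefect≡spread G (totalDefect≡0⇒balanced (deleteZero G) rest≡0)))
... | no rest≢0 | inj₁ rest≡0 = ⊥-elim (rest≢0 rest≡0)
... | no rest≢0 | inj₂ n≤rest = inj₂ (subst₂ _≤_ (ℕₚ.+-comm n 1) (sym (totalDefect-split G))
  (ℕₚ.+-mono-≤ n≤rest (starDefect-positive G (ℕₚ.n≢0⇒n>0 rest≢0))))

-- Switching to K_n^*

SupportedOn : ∀ {n} → Gains n → Fin n → Fin n → Set
SupportedOn H u v = ∀ i j → (i ≡ u → j ≢ v) → (i ≡ v → j ≢ u) → φ H i j ≡ zero

IsKstar : ∀ {n} → Gains n → Fin n → Fin n → Set
IsKstar H u v = φ H u v ≡ ω × SupportedOn H u v

KstarSwitchable : ∀ {n} → Gains n → Set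
KstarSwitchable G = ∃ λ y → ∃₂ λ u v → IsKstar (switching y G) u v

kstarSwitchable : ∀ {n} (G : Gains n) y {u v} → SupportedOn (switching y G) u v →
  defect (φ (switching y G) u v) ≡ 1 → KstarSwitchable G
kstarSwitchable G y {u} {v} supported defect≡1 with defect≡1⇒ω⊎ω̄ (φ (switching y G) u v) defect≡1
... | inj₁ ≡ω = y , u , v , ≡ω , supported
... | inj₂ ≡ω̄ = y , v , u , trans (φ-anti (switching y G) u v) (cong ⊖_ ≡ω̄) , λ i j h₁ h₂ → supported i j h₂ h₁

twoVertices-kstarSwitchable : (G : Gains 2) → KstarSwitchable G
twoVertices-kstarSwitchable G = kstarSwitchable G y supported (cong defect (switched-gain (φ G zero (suc zero))))
  where
  y : Fin 2 → T6
  y zero = zero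
  y (suc zero) = φ G zero (suc zero) ⊕ ω̄
  switched-gain : ∀ g → zero ⊕ g ⊕ ⊖ (g ⊕ ω̄) ≡ ω
  switched-gain = exhaustive₁ _≟_
  supported : SupportedOn (switching y G) zero (suc zero)
  supported zero zero _ _ = φ-diag (switching y G) zero
  supported zero (suc zero) not-01 _ = ⊥-elim (not-01 refl refl)
  supported (suc zero) zero _ not-10 = ⊥-elim (not-10 refl refl)
  supported (suc zero) (suc zero) _ _ = φ-diag (switching y G) (suc zero)

-- Switching by the gains at 0 turns every gain into a triangle through 0; the correction
-- c ⊖ κ i then trivialises all edges avoiding 0, by triangle-potential.
module Levelling {n} (G : Gains (suc (suc n))) (balanced : ∀ i j l → triangle (deleteZero G) i j l ≡ zero)
                 (c : T6) where

  private
    κ = potential G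

    correction : Fin (suc (suc n)) → T6
    correction zero = zero
    correction (suc i) = c ⊕ ⊖ κ i

  levelling : Fin (suc (suc n)) → T6
  levelling i = φ G zero i ⊕ correction i

  private
    H = switching levelling G

    H-φ : ∀ i j → φ H i j ≡ (correction i ⊕ ⊖ correction j) ⊕ triangle G zero i j
    H-φ i j = trans (switching-⊕ G (φ G zero) correction i j)
                    (cong ((correction i ⊕ ⊖ correction j) ⊕_) (switching-by-row G zero i j))

  levelling-inner : ∀ i j → φ H (suc i) (suc j) ≡ zero
  levelling-inner i j = begin
    φ H (suc i) (suc j)
      ≡⟨ H-φ (suc i) (suc j) ⟩
    (c ⊕ ⊖ κ i ⊕ ⊖ (c ⊕ ⊖ κ j)) ⊕ triangle G zero (suc i) (suc j)
      ≡⟨ cong ((c ⊕ ⊖ κ i ⊕ ⊖ (c ⊕ ⊖ κ j)) ⊕_) (triangle-potential G balanced i j) ⟩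
    (c ⊕ ⊖ κ i ⊕ ⊖ (c ⊕ ⊖ κ j)) ⊕ (κ i ⊕ ⊖ κ j)
      ≡⟨ ⊕-⊖-interchange (c ⊕ ⊖ κ i) (c ⊕ ⊖ κ j) (κ i) (κ j) ⟩
    (c ⊕ ⊖ κ i ⊕ κ i) ⊕ ⊖ (c ⊕ ⊖ κ j ⊕ κ j)
      ≡⟨ cong₂ (λ a b → a ⊕ ⊖ b) (⊕-⊖-⊕ c (κ i)) (⊕-⊖-⊕ c (κ j)) ⟩
    c ⊕ ⊖ c
      ≡⟨ ⊕-inverseʳ c ⟩
    zero ∎
    where open ≡-Reasoning

  levelling-spoke : ∀ j → φ H zero (suc j) ≡ κ j ⊕ ⊖ c
  levelling-spoke j = begin
    φ H zero (suc j)                                        ≡⟨ H-φ zero (suc j) ⟩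
    (zero ⊕ ⊖ (c ⊕ ⊖ κ j)) ⊕ triangle G zero zero (suc j)   ≡⟨ cong ((zero ⊕ ⊖ (c ⊕ ⊖ κ j)) ⊕_)
                                                                    (triangle-degenerate G zero (suc j)) ⟩
    (zero ⊕ ⊖ (c ⊕ ⊖ κ j)) ⊕ zero                           ≡⟨ ⊕-identityʳ (zero ⊕ ⊖ (c ⊕ ⊖ κ j)) ⟩
    zero ⊕ ⊖ (c ⊕ ⊖ κ j)                                    ≡⟨ ⊕-identityˡ (⊖ (c ⊕ ⊖ κ j)) ⟩
    ⊖ (c ⊕ ⊖ κ j)                                           ≡⟨ ⊖-difference c (κ j) ⟩
    κ j ⊕ ⊖ c                                               ∎
    where open ≡-Reasoning

extremal-balancedRest : ∀ {n} (G : Gains (suc (suc n))) → (∀ i j l → triangle (deleteZero G) i j l ≡ zero) →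
  (∃₂ λ p c → defect (potential G p ⊕ ⊖ c) ≡ 1 × (∀ i → i ≢ p → potential G i ≡ c)) → KstarSwitchable G
extremal-balancedRest G balanced (p , c , defect≡1 , others) =
  kstarSwitchable G levelling supported (trans (cong defect (levelling-spoke p)) defect≡1)
  where
  open Levelling G balanced c
  H = switching levelling G
  plainSpoke : ∀ j → j ≢ p → φ H zero (suc j) ≡ zero
  plainSpoke j j≢p = trans (levelling-spoke j) (trans (cong (_⊕ ⊖ c) (others j j≢p)) (⊕-inverseʳ c))
  supported : SupportedOn H zero (suc p)
  supported zero zero _ _ = φ-diag H zero
  supported zero (suc j) not-special _ = plainSpoke j (not-special refl ∘ cong suc)
  supported (suc i) zero _ not-special =
    trans (φ-anti H zero (suc i)) (cong ⊖_ (plainSpoke i (λ i≡p → not-special (cong suc i≡p) refl)))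
  supported (suc i) (suc j) _ _ = levelling-inner i j

extremal-starPair : ∀ {n} (G : Gains (suc n)) →
  (∃₂ λ a b → defect (triangle G zero (suc a) (suc b)) ≡ 1 ×
              (∀ i j → i < j → (i ≡ a → j ≢ b) → triangle G zero (suc i) (suc j) ≡ zero)) →
  KstarSwitchable G
extremal-starPair G (a , b , defect≡1 , vanish) =
  kstarSwitchable G (φ G zero) supported (trans (cong defect (switching-by-row G zero (suc a) (suc b))) defect≡1)
  where
  H = switching (φ G zero) G
  supported : SupportedOn H (suc a) (suc b)
  supported zero j _ _ = trans (switching-by-row G zero zero j) (triangle-degenerate G zero j)
  supported (suc i) zero _ _ = trans (switching-by-row G zero (suc i) zero) (triangle-degenerate′ G zero (suc i))
  supported (suc i) (suc j) not-ab not-ba = byOrder (<-cmp i j)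
    where
    byOrder : Tri (i < j) (i ≡ j) (j < i) → φ H (suc i) (suc j) ≡ zero
    byOrder (tri< i<j _ _) = trans (switching-by-row G zero (suc i) (suc j))
                                   (vanish i j i<j (λ i≡a j≡b → not-ab (cong suc i≡a) (cong suc j≡b)))
    byOrder (tri≈ _ refl _) = φ-diag H (suc i)
    byOrder (tri> _ _ j<i) = trans (φ-anti H (suc j) (suc i)) (cong ⊖_ (trans (switching-by-row G zero (suc j) (suc i))
                                   (vanish j i j<i (λ j≡a i≡b → not-ba (cong suc i≡b) (cong suc j≡a)))))

starDefect-forced : ∀ {n} (G : Gains (suc (suc (suc n)))) → totalDefect G ≡ suc n →
  totalDefect (deleteZero G) ≢ 0 → starDefect G ≡ 1
starDefect-forced {n} G total≡ rest≢0 with totalDefect-lowerBound (deleteZero G)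
... | inj₁ rest≡0 = ⊥-elim (rest≢0 rest≡0)
... | inj₂ n≤rest = sym (proj₂ (+-≤-≡-split n≤rest (starDefect-positive G (ℕₚ.n≢0⇒n>0 rest≢0))
                                 (trans (ℕₚ.+-comm n 1) (trans (sym total≡) (totalDefect-split G)))))

totalDefect-extremal : ∀ {n} (G : Gains (suc (suc (suc n)))) → totalDefect G ≡ suc n → KstarSwitchable G
totalDefect-extremal {n} G total≡ with totalDefect (deleteZero G) ℕ.≟ 0
... | no rest≢0 = extremal-starPair G (starDefect≡1 G (starDefect-forced G total≡ rest≢0))
... | yes rest≡0 = extremal-balancedRest G balanced (spread-extremal (potential G) spread≡)
  where
  open ≡-Reasoning
  balanced = totalDefect≡0⇒balanced (deleteZero G) rest≡0
  spread≡ : spread (potential G) ≡ suc n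
  spread≡ = begin
    spread (potential G)                        ≡⟨ starDefect≡spread G balanced ⟨
    starDefect G                                ≡⟨ cong (_+ starDefect G) rest≡0 ⟨
    totalDefect (deleteZero G) + starDefect G   ≡⟨ totalDefect-split G ⟨
    totalDefect G                               ≡⟨ total≡ ⟩
    suc n                                       ∎

totalDefect≡⇒kstarSwitchable : ∀ k (G : Gains (suc (suc k))) → totalDefect G ≡ k → KstarSwitchable G
totalDefect≡⇒kstarSwitchable zero G _ = twoVertices-kstarSwitchable G
totalDefect≡⇒kstarSwitchable (suc k) G total≡ = totalDefect-extremal G total≡

-- Spectral invariants

cospectral⇒principalMinorSum : ∀ {n} (Ψ Φ : SignedDigraph n) → Cospectral Ψ Φ →
  ∀ k → principalMinorSum k (Eis Ψ) ≡ principalMinorSum k (Eis Φ)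
cospectral⇒principalMinorSum {n} Ψ Φ cospectral k with k ℕ.≤? n
... | yes k≤n = begin
  principalMinorSum k (Eis Ψ)          ≡⟨ coeff-charPoly-minors n (Eis Ψ) (n ∸ k) k (ℕₚ.m∸n+n≡m k≤n) ⟨
  coeff (charPoly (Eis Ψ)) (n ∸ k)     ≡⟨ cospectral (n ∸ k) ⟩
  coeff (charPoly (Eis Φ)) (n ∸ k)     ≡⟨ coeff-charPoly-minors n (Eis Φ) (n ∸ k) k (ℕₚ.m∸n+n≡m k≤n) ⟩
  principalMinorSum k (Eis Φ)          ∎
  where open ≡-Reasoning
... | no k≰n = trans (sumSubsets-oversized refl n k _ n<k) (sym (sumSubsets-oversized refl n k _ n<k))
  where n<k = ℕₚ.≰⇒> k≰n

cospectral⇒sameOrder : ∀ {m n} (Ψ : SignedDigraph m) (Φ : SignedDigraph n) → Cospectral Ψ Φ → m ≡ n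
cospectral⇒sameOrder {m} {n} Ψ Φ cospectral with ℕₚ.<-cmp m n
... | tri≈ _ m≡n _ = m≡n
... | tri< m<n _ _ = ⊥-elim (0ᵉ≢1ᵉ (trans (sym (coeff-charPoly-above m (Eis Ψ) n m<n))
                                            (trans (cospectral n) (coeff-charPoly-top n (Eis Φ)))))
... | tri> _ _ n<m = ⊥-elim (0ᵉ≢1ᵉ (trans (sym (coeff-charPoly-above n (Eis Φ) m n<m))
                                            (trans (sym (cospectral m)) (coeff-charPoly-top m (Eis Ψ)))))

-- non-adjacent pairs get the junk gain 1; this is only used for complete digraphs
gainsOf : ∀ {n} → SignedDigraph n → Gains n
gainsOf Ψ = record { φ = λ i j → fromMaybe zero (gain Ψ i j) ; φ-anti = anti ; φ-diag = diag }
  where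
  anti : ∀ i j → fromMaybe zero (gain Ψ j i) ≡ ⊖ fromMaybe zero (gain Ψ i j)
  anti i j rewrite herm Ψ i j with gain Ψ i j
  ... | nothing = refl
  ... | just g = refl
  diag : ∀ i → fromMaybe zero (gain Ψ i i) ≡ zero
  diag i rewrite loopless Ψ i = refl

Complete : ∀ {n} → SignedDigraph n → Set
Complete Ψ = ∀ i j → i ≢ j → gain Ψ i j ≢ nothing

Eis-complete : ∀ {n} (Ψ : SignedDigraph n) → Complete Ψ → ∀ i j → i ≢ j → Eis Ψ i j ≡ toℤω (φ (gainsOf Ψ) i j)
Eis-complete Ψ complete i j i≢j with gain Ψ i j | complete i j i≢j
... | nothing | nonEdge = ⊥-elim (nonEdge refl)
... | just g | _ = refl

Eis-diag : ∀ {n} (Ψ : SignedDigraph n) i → Eis Ψ i i ≡ 0ᵉ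
Eis-diag Ψ i = cong (maybe toℤω 0ᵉ) (loopless Ψ i)

fromℕᵉ : ℕ → ℤω
fromℕᵉ x = ew (ℤ.+ x) (ℤ.+ 0)

fromℕᵉ-injective : ∀ {x y} → fromℕᵉ x ≡ fromℕᵉ y → x ≡ y
fromℕᵉ-injective refl = refl

fromℕᵉ-+ᵉ-cancelʳ : ∀ {x y M} → fromℕᵉ x +ᵉ M ≡ fromℕᵉ y +ᵉ M → x ≡ y
fromℕᵉ-+ᵉ-cancelʳ {x} {y} {M} eq = ℤₚ.+-injective (∙-cancelʳ (ℤω.re M) (ℤ.+ x) (ℤ.+ y) (cong ℤω.re eq))

adjacency : ∀ {n} → SignedDigraph n → Σ ℕ (Vec (Fin n)) → ℕ
adjacency Ψ (2 , i ∷ j ∷ []) = maybe (λ _ → 1) 0 (gain Ψ i j)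
adjacency Ψ _ = 0

negMatrix₂ : ℤω → ℤω → Matrix 2
negMatrix₂ x y zero zero = -ᵉ 0ᵉ
negMatrix₂ x y zero (suc zero) = -ᵉ x
negMatrix₂ x y (suc zero) zero = -ᵉ y
negMatrix₂ x y (suc zero) (suc zero) = -ᵉ 0ᵉ

detᵉ-negMatrix₂ : ∀ g → detᵉ 2 (negMatrix₂ (toℤω g) (toℤω (conj6 g))) ≡ -ᵉ 1ᵉ
detᵉ-negMatrix₂ = exhaustive₁ _≟ᵉ_

detᵉ-pair : ∀ m → detᵉ 2 (negMatrix₂ (maybe toℤω 0ᵉ m) (maybe toℤω 0ᵉ (Maybe.map conj6 m)))
                 ≡ -ᵉ fromℕᵉ (maybe (λ _ → 1) 0 m)
detᵉ-pair nothing = refl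
detᵉ-pair (just g) = detᵉ-negMatrix₂ g

pair-principalMinor : ∀ {n} (Ψ : SignedDigraph n) p → size p ≡ 2 →
  principalMinor p (negᴹ (Eis Ψ)) ≡ -ᵉ fromℕᵉ (adjacency Ψ (elements p))
pair-principalMinor Ψ p size≡2 with pair-shape p size≡2
... | i , j , eq , _ rewrite eq = trans (detᵉ-cong 2 entries) (detᵉ-pair (gain Ψ i j))
  where
  entries : ∀ a b → principal (i ∷ j ∷ []) (negᴹ (Eis Ψ)) a b
                  ≡ negMatrix₂ (Eis Ψ i j) (maybe toℤω 0ᵉ (Maybe.map conj6 (gain Ψ i j))) a b
  entries zero zero = cong -ᵉ_ (Eis-diag Ψ i)
  entries zero (suc zero) = refl
  entries (suc zero) zero = cong (-ᵉ_ ∘ maybe toℤω 0ᵉ) (herm Ψ i j)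
  entries (suc zero) (suc zero) = cong -ᵉ_ (Eis-diag Ψ j)

minus2ᵉ : ℤω
minus2ᵉ = ew (ℤ.- ℤ.+ 2) (ℤ.+ 0)

negMatrix₃ : T6 → T6 → T6 → Matrix 3
negMatrix₃ a b c zero zero = -ᵉ 0ᵉ
negMatrix₃ a b c zero (suc zero) = -ᵉ toℤω a
negMatrix₃ a b c zero (suc (suc zero)) = -ᵉ toℤω (⊖ c)
negMatrix₃ a b c (suc zero) zero = -ᵉ toℤω (⊖ a)
negMatrix₃ a b c (suc zero) (suc zero) = -ᵉ 0ᵉ
negMatrix₃ a b c (suc zero) (suc (suc zero)) = -ᵉ toℤω b
negMatrix₃ a b c (suc (suc zero)) zero = -ᵉ toℤω c
negMatrix₃ a b c (suc (suc zero)) (suc zero) = -ᵉ toℤω (⊖ b)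
negMatrix₃ a b c (suc (suc zero)) (suc (suc zero)) = -ᵉ 0ᵉ

-- for a triangle with edge gains a, b, c the minor is -2 Re ω^(a+b+c) = defect (a ⊕ b ⊕ c) - 2
detᵉ-negMatrix₃ : ∀ a b c → detᵉ 3 (negMatrix₃ a b c) ≡ fromℕᵉ (defect (a ⊕ b ⊕ c)) +ᵉ minus2ᵉ
detᵉ-negMatrix₃ = exhaustive₃ _≟ᵉ_

triple-principalMinor : ∀ {n} (Ψ : SignedDigraph n) → Complete Ψ → ∀ p → size p ≡ 3 →
  principalMinor p (negᴹ (Eis Ψ)) ≡ fromℕᵉ (tripleDefect (gainsOf Ψ) (elements p)) +ᵉ minus2ᵉ
triple-principalMinor Ψ complete p size≡3 with triple-shape p size≡3
... | i , j , l , eq , i<j , j<l rewrite eq =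
  trans (detᵉ-cong 3 entries) (detᵉ-negMatrix₃ (φ G i j) (φ G j l) (φ G l i))
  where
  G = gainsOf Ψ
  i<l = ℕₚ.<-trans i<j j<l
  edge : ∀ {a b} → a ≢ b → negᴹ (Eis Ψ) a b ≡ -ᵉ toℤω (φ G a b)
  edge a≢b = cong -ᵉ_ (Eis-complete Ψ complete _ _ a≢b)
  reversed : ∀ {a b} → b ≢ a → negᴹ (Eis Ψ) a b ≡ -ᵉ toℤω (⊖ φ G b a)
  reversed b≢a = trans (edge (b≢a ∘ sym)) (cong (-ᵉ_ ∘ toℤω) (φ-anti G _ _))
  entries : ∀ a b → principal (i ∷ j ∷ l ∷ []) (negᴹ (Eis Ψ)) a b ≡ negMatrix₃ (φ G i j) (φ G j l) (φ G l i) a b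
  entries zero zero = cong -ᵉ_ (Eis-diag Ψ i)
  entries zero (suc zero) = edge (<⇒≢ i<j)
  entries zero (suc (suc zero)) = reversed (<⇒≢ i<l ∘ sym)
  entries (suc zero) zero = reversed (<⇒≢ i<j)
  entries (suc zero) (suc zero) = cong -ᵉ_ (Eis-diag Ψ j)
  entries (suc zero) (suc (suc zero)) = edge (<⇒≢ j<l)
  entries (suc (suc zero)) zero = edge (<⇒≢ i<l ∘ sym)
  entries (suc (suc zero)) (suc zero) = reversed (<⇒≢ j<l)
  entries (suc (suc zero)) (suc (suc zero)) = cong -ᵉ_ (Eis-diag Ψ l)

principalMinorSum-pairs : ∀ {n} (Ψ : SignedDigraph n) →
  principalMinorSum 2 (Eis Ψ) ≡ -ᵉ fromℕᵉ (sumℕ n 2 (adjacency Ψ ∘ elements))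
principalMinorSum-pairs {n} Ψ =
  trans (sumSubsets-congOn n 2 (pair-principalMinor Ψ))
        (sym (sumSubsets-hom (-ᵉ_ ∘ fromℕᵉ) refl (λ x y → -ᵉ-distrib-+ᵉ (fromℕᵉ x) (fromℕᵉ y)) n 2 _))

principalMinorSum-triples : ∀ {n} (Ψ : SignedDigraph n) → Complete Ψ →
  principalMinorSum 3 (Eis Ψ) ≡ fromℕᵉ (totalDefect (gainsOf Ψ)) +ᵉ sumᵉ n 3 (λ _ → minus2ᵉ)
principalMinorSum-triples {n} Ψ complete = begin
  principalMinorSum 3 (Eis Ψ)
    ≡⟨ sumSubsets-congOn n 3 (triple-principalMinor Ψ complete) ⟩
  sumᵉ n 3 (λ p → fromℕᵉ (defects p) +ᵉ minus2ᵉ)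
    ≡⟨ sumᵉ-+ n 3 (fromℕᵉ ∘ defects) (λ _ → minus2ᵉ) ⟩
  sumᵉ n 3 (fromℕᵉ ∘ defects) +ᵉ sumᵉ n 3 (λ _ → minus2ᵉ)
    ≡⟨ cong (_+ᵉ sumᵉ n 3 (λ _ → minus2ᵉ)) (sumSubsets-hom fromℕᵉ refl (λ _ _ → refl) n 3 defects) ⟨
  fromℕᵉ (totalDefect (gainsOf Ψ)) +ᵉ sumᵉ n 3 (λ _ → minus2ᵉ) ∎
  where
  open ≡-Reasoning
  defects = tripleDefect (gainsOf Ψ) ∘ elements

nonEdge-sym : ∀ {n} (Ψ : SignedDigraph n) {i j} → gain Ψ i j ≡ nothing → gain Ψ j i ≡ nothing
nonEdge-sym Ψ {i} {j} nonEdge with gain Ψ j i | herm Ψ j i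
... | nothing | _ = refl
... | just _ | eq with () ← trans (sym nonEdge) eq

adjacency≤1 : ∀ {n} (Ψ : SignedDigraph n) e → adjacency Ψ e ≤ 1
adjacency≤1 Ψ (2 , i ∷ j ∷ []) with gain Ψ i j
... | nothing = z≤n
... | just _ = ℕₚ.≤-refl
adjacency≤1 Ψ (0 , []) = z≤n
adjacency≤1 Ψ (1 , _) = z≤n
adjacency≤1 Ψ (suc (suc (suc _)) , _) = z≤n

cospectral⇒complete : ∀ {n} (Ψ Φ : SignedDigraph n) → Cospectral Ψ Φ → Complete Φ → Complete Ψ
cospectral⇒complete {n} Ψ Φ cospectral completeΦ i j i≢j = byOrder (<-cmp i j)
  where
  open ≡-Reasoning
  adjΨ = adjacency Ψ ∘ elements
  adjΦ = adjacency Φ ∘ elements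
  edgeCounts : sumℕ n 2 adjΨ ≡ sumℕ n 2 adjΦ
  edgeCounts = fromℕᵉ-injective (-ᵉ-injective (begin
    -ᵉ fromℕᵉ (sumℕ n 2 adjΨ)      ≡⟨ principalMinorSum-pairs Ψ ⟨
    principalMinorSum 2 (Eis Ψ)    ≡⟨ cospectral⇒principalMinorSum Ψ Φ cospectral 2 ⟩
    principalMinorSum 2 (Eis Φ)    ≡⟨ principalMinorSum-pairs Φ ⟩
    -ᵉ fromℕᵉ (sumℕ n 2 adjΦ)      ∎))
  adjΦ≡1 : ∀ p → size p ≡ 2 → adjΦ p ≡ 1
  adjΦ≡1 p size≡2 with pair-shape p size≡2
  ... | a , b , eq , a<b rewrite eq with gain Φ a b | completeΦ a b (<⇒≢ a<b)
  ...   | nothing | nonEdge = ⊥-elim (nonEdge refl)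
  ...   | just _ | _ = refl
  adjΨ≡adjΦ : ∀ p → size p ≡ 2 → adjΨ p ≡ adjΦ p
  adjΨ≡adjΦ = sumℕ-≡⇒≡ n 2 (λ p size≡2 → subst (adjΨ p ≤_) (sym (adjΦ≡1 p size≡2)) (adjacency≤1 Ψ (elements p))) edgeCounts
  ordered : ∀ {a b} → a < b → gain Ψ a b ≢ nothing
  ordered {a} {b} a<b nonEdge with pair-subset a<b
  ... | p , eq = ℕₚ.0≢1+n (begin
    0                                 ≡⟨ cong (maybe (λ _ → 1) 0) nonEdge ⟨
    maybe (λ _ → 1) 0 (gain Ψ a b)    ≡⟨ cong (adjacency Ψ) eq ⟨
    adjΨ p                            ≡⟨ adjΨ≡adjΦ p (size-of eq) ⟩
    adjΦ p                            ≡⟨ adjΦ≡1 p (size-of eq) ⟩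
    1                                 ∎)
  byOrder : Tri (i < j) (i ≡ j) (j < i) → gain Ψ i j ≢ nothing
  byOrder (tri< i<j _ _) = ordered i<j
  byOrder (tri≈ _ i≡j _) = ⊥-elim (i≢j i≡j)
  byOrder (tri> _ _ j<i) = ordered j<i ∘ nonEdge-sym Ψ

cospectral⇒totalDefect : ∀ {n} (Ψ Φ : SignedDigraph n) → Cospectral Ψ Φ → Complete Ψ → Complete Φ →
  totalDefect (gainsOf Ψ) ≡ totalDefect (gainsOf Φ)
cospectral⇒totalDefect {n} Ψ Φ cospectral completeΨ completeΦ = fromℕᵉ-+ᵉ-cancelʳ {M = −2s} (begin
  fromℕᵉ (totalDefect (gainsOf Ψ)) +ᵉ −2s   ≡⟨ principalMinorSum-triples Ψ completeΨ ⟨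
  principalMinorSum 3 (Eis Ψ)               ≡⟨ cospectral⇒principalMinorSum Ψ Φ cospectral 3 ⟩
  principalMinorSum 3 (Eis Φ)               ≡⟨ principalMinorSum-triples Φ completeΦ ⟩
  fromℕᵉ (totalDefect (gainsOf Φ)) +ᵉ −2s   ∎)
  where
  open ≡-Reasoning
  −2s = sumᵉ n 3 (λ _ → minus2ᵉ)

kgain-trivial : ∀ {n} (i j : Fin n) → fromMaybe zero (kgain i j) ≡ zero
kgain-trivial i j with does (i ≟ j)
... | true = refl
... | false = refl

kgain-edge : ∀ {n} (i j : Fin n) → i ≢ j → kgain i j ≢ nothing
kgain-edge i j i≢j rewrite dec-false (i ≟ j) i≢j = λ ()

ksgain-suc-suc : ∀ {k} (i j : Fin (suc k)) → ksgain (suc i) (suc j) ≡ kgain (suc i) (suc j)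
ksgain-suc-suc zero j = refl
ksgain-suc-suc (suc i) j = refl

K-complete : ∀ n → Complete (K n)
K-complete n = kgain-edge

Kstar-complete : ∀ k → Complete (Kstar k)
Kstar-complete k zero zero 0≢0 = ⊥-elim (0≢0 refl)
Kstar-complete k zero (suc zero) _ = λ ()
Kstar-complete k zero (suc (suc j)) = kgain-edge zero (suc (suc j))
Kstar-complete k (suc zero) zero _ = λ ()
Kstar-complete k (suc i) (suc j) i≢j rewrite ksgain-suc-suc i j = kgain-edge (suc i) (suc j) i≢j
Kstar-complete k (suc (suc i)) zero = kgain-edge (suc (suc i)) zero

Kstar-trivial : ∀ k (i j : Fin (suc (suc k))) → (i ≡ zero → j ≢ suc zero) → (i ≡ suc zero → j ≢ zero) →
  φ (gainsOf (Kstar k)) i j ≡ zero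
Kstar-trivial k zero zero _ _ = refl
Kstar-trivial k zero (suc zero) not01 _ = ⊥-elim (not01 refl refl)
Kstar-trivial k zero (suc (suc j)) _ _ = kgain-trivial zero (suc (suc j))
Kstar-trivial k (suc zero) zero _ not10 = ⊥-elim (not10 refl refl)
Kstar-trivial k (suc i) (suc j) _ _ = trans (cong (fromMaybe zero) (ksgain-suc-suc i j)) (kgain-trivial (suc i) (suc j))
Kstar-trivial k (suc (suc i)) zero _ _ = kgain-trivial (suc (suc i)) zero

K-totalDefect : ∀ n → totalDefect (gainsOf (K n)) ≡ 0
K-totalDefect n = totalDefect-trivial (gainsOf (K n)) kgain-trivial

Kstar-totalDefect : ∀ k → totalDefect (gainsOf (Kstar k)) ≡ k
Kstar-totalDefect k = begin
  totalDefect G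
    ≡⟨ totalDefect-split G ⟩
  totalDefect (deleteZero G) + starDefect G
    ≡⟨ cong₂ _+_ restTrivial (starDefect≡spread G (totalDefect≡0⇒balanced (deleteZero G) restTrivial)) ⟩
  spread (potential G)
    ≡⟨ spread-split (potential G) ⟩
  spread (potential G ∘ suc) + spreadFromZero (potential G)
    ≡⟨ cong₂ _+_ (spread-constant (potential G ∘ suc) ω̄ (λ _ → refl)) (spreadFromZero-const (potential G) ω̄ (λ _ → refl)) ⟩
  k * 1
    ≡⟨ ℕₚ.*-identityʳ k ⟩
  k ∎
  where
  open ≡-Reasoning
  G = gainsOf (Kstar k)
  restTrivial : totalDefect (deleteZero G) ≡ 0
  restTrivial = totalDefect-trivial (deleteZero G) (λ i j → Kstar-trivial k (suc i) (suc j) (λ ()) (λ _ ()))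

switchingStep : ∀ {n} {Ψ Φ : SignedDigraph n} (y : Fin n → T6) → Complete Ψ → Complete Φ →
  (∀ i j → φ (gainsOf Φ) i j ≡ φ (switching y (gainsOf Ψ)) i j) → Step (n , Ψ) (n , Φ)
switchingStep {Ψ = Ψ} {Φ} y completeΨ completeΦ gains≡ = switch y Eis≡
  where
  open ≡-Reasoning
  Eis≡ : ∀ i j → Eis Φ i j ≡ toℤω (y i) *ᵉ Eis Ψ i j *ᵉ conjᵉ (toℤω (y j))
  Eis≡ i j with i ≟ j
  ... | yes refl = begin
    Eis Φ i i                                        ≡⟨ Eis-diag Φ i ⟩
    0ᵉ                                               ≡⟨ *ᵉ-zeroˡ (conjᵉ (toℤω (y i))) ⟨
    0ᵉ *ᵉ conjᵉ (toℤω (y i))                         ≡⟨ cong (_*ᵉ conjᵉ (toℤω (y i))) (*ᵉ-zeroʳ (toℤω (y i))) ⟨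
    toℤω (y i) *ᵉ 0ᵉ *ᵉ conjᵉ (toℤω (y i))           ≡⟨ cong (λ x → toℤω (y i) *ᵉ x *ᵉ conjᵉ (toℤω (y i))) (Eis-diag Ψ i) ⟨
    toℤω (y i) *ᵉ Eis Ψ i i *ᵉ conjᵉ (toℤω (y i))    ∎
  ... | no i≢j = begin
    Eis Φ i j                                        ≡⟨ Eis-complete Φ completeΦ i j i≢j ⟩
    toℤω (φ (gainsOf Φ) i j)                         ≡⟨ cong toℤω (gains≡ i j) ⟩
    toℤω (y i ⊕ g ⊕ ⊖ y j)                           ≡⟨ toℤω-⊕ (y i ⊕ g) (⊖ y j) ⟩
    toℤω (y i ⊕ g) *ᵉ toℤω (⊖ y j)                   ≡⟨ cong₂ _*ᵉ_ (toℤω-⊕ (y i) g) (toℤω-⊖ (y j)) ⟩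
    toℤω (y i) *ᵉ toℤω g *ᵉ conjᵉ (toℤω (y j))       ≡⟨ cong (λ x → toℤω (y i) *ᵉ x *ᵉ conjᵉ (toℤω (y j)))
                                                             (Eis-complete Ψ completeΨ i j i≢j) ⟨
    toℤω (y i) *ᵉ Eis Ψ i j *ᵉ conjᵉ (toℤω (y j))    ∎
    where g = φ (gainsOf Ψ) i j

relabelled : ∀ {n} → (Fin n → Fin n) → SignedDigraph n → SignedDigraph n
relabelled σ Ψ = record
  { gain = λ i j → gain Ψ (σ i) (σ j) ; loopless = loopless Ψ ∘ σ ; herm = λ i j → herm Ψ (σ i) (σ j) }

relabelStep : ∀ {n} (π : Permutation′ n) (Ψ : SignedDigraph n) → Step (n , Ψ) (n , relabelled (π ⟨$⟩ʳ_) Ψ)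
relabelStep π Ψ = relabel π (λ _ _ → refl)

permutation-injective : ∀ {n} (π : Permutation′ n) {a b} → π ⟨$⟩ʳ a ≡ π ⟨$⟩ʳ b → a ≡ b
permutation-injective π {a} {b} πa≡πb = trans (sym (inverseˡ π)) (trans (cong (π ⟨$⟩ˡ_) πa≡πb) (inverseˡ π))

relabelled-complete : ∀ {n} (π : Permutation′ n) (Ψ : SignedDigraph n) → Complete Ψ → Complete (relabelled (π ⟨$⟩ʳ_) Ψ)
relabelled-complete π Ψ complete i j i≢j = complete (π ⟨$⟩ʳ i) (π ⟨$⟩ʳ j) (i≢j ∘ permutation-injective π)

transpose-first : ∀ {n} (i j : Fin n) → PC.transpose i j i ≡ j
transpose-first i j rewrite dec-true (i ≟ i) refl = refl

transpose-elsewhere : ∀ {n} (i j k : Fin n) → k ≢ i → k ≢ j → PC.transpose i j k ≡ k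
transpose-elsewhere i j k k≢i k≢j rewrite dec-false (k ≟ i) k≢i | dec-false (k ≟ j) k≢j = refl

balanced⇒switchingIsomorphic : ∀ n (Ψ : SignedDigraph (suc n)) → Complete Ψ →
  (∀ i j l → triangle (gainsOf Ψ) i j l ≡ zero) → SwitchingIsomorphic (suc n , Ψ) (suc n , K (suc n))
balanced⇒switchingIsomorphic n Ψ complete balanced =
  switchingStep (φ (gainsOf Ψ) zero) complete (K-complete (suc n)) trivial ◅ ε
  where
  trivial : ∀ i j → φ (gainsOf (K (suc n))) i j ≡ φ (switching (φ (gainsOf Ψ) zero) (gainsOf Ψ)) i j
  trivial i j = trans (kgain-trivial i j) (sym (trans (switching-by-row (gainsOf Ψ) zero i j) (balanced zero i j)))

-- Relabel so that the special edge (u , v) becomes (0 , 1), then switch.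
kstarSwitchable⇒switchingIsomorphic : ∀ k (Ψ : SignedDigraph (suc (suc k))) → Complete Ψ →
  KstarSwitchable (gainsOf Ψ) → SwitchingIsomorphic (suc (suc k) , Ψ) (suc (suc k) , Kstar k)
kstarSwitchable⇒switchingIsomorphic k Ψ complete (y , u , v , special≡ω , supported) =
  relabelStep π Ψ ◅ switchingStep (y ∘ σ) (relabelled-complete π Ψ complete) (Kstar-complete k) matches ◅ ε
  where
  H = switching y (gainsOf Ψ)
  u≢v : u ≢ v
  u≢v refl with () ← trans (sym special≡ω) (φ-diag H u)
  w = PC.transpose u zero v
  w≢0 : w ≢ zero
  w≢0 w≡0 = u≢v (sym (trans (sym (PC.transpose-inverse zero u)) (trans (cong (PC.transpose zero u) w≡0) (transpose-first zero u))))
  π : Permutation′ (suc (suc k))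
  π = Perm.transpose (suc zero) w Perm.∘ₚ Perm.transpose zero u
  σ = π ⟨$⟩ʳ_
  σ0≡u : σ zero ≡ u
  σ0≡u = trans (cong (PC.transpose zero u) (transpose-elsewhere (suc zero) w zero (λ ()) (w≢0 ∘ sym))) (transpose-first zero u)
  σ1≡v : σ (suc zero) ≡ v
  σ1≡v = trans (cong (PC.transpose zero u) (transpose-first (suc zero) w)) (PC.transpose-inverse zero u)
  elsewhere : ∀ i j → (i ≡ zero → j ≢ suc zero) → (i ≡ suc zero → j ≢ zero) →
    φ (gainsOf (Kstar k)) i j ≡ φ H (σ i) (σ j)
  elsewhere i j not01 not10 = trans (Kstar-trivial k i j not01 not10) (sym (supported (σ i) (σ j)
    (λ σi≡u σj≡v → not01 (permutation-injective π (trans σi≡u (sym σ0≡u))) (permutation-injective π (trans σj≡v (sym σ1≡v))))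
    (λ σi≡v σj≡u → not10 (permutation-injective π (trans σi≡v (sym σ1≡v))) (permutation-injective π (trans σj≡u (sym σ0≡u))))))
  matches : ∀ i j → φ (gainsOf (Kstar k)) i j ≡ φ H (σ i) (σ j)
  matches zero (suc zero) = sym (trans (cong₂ (φ H) σ0≡u σ1≡v) special≡ω)
  matches (suc zero) zero = sym (trans (cong₂ (φ H) σ1≡v σ0≡u) (trans (φ-anti H u v) (cong ⊖_ special≡ω)))
  matches zero zero = elsewhere zero zero (λ _ ()) (λ ())
  matches zero (suc (suc j)) = elsewhere zero (suc (suc j)) (λ _ ()) (λ ())
  matches (suc zero) (suc j) = elsewhere (suc zero) (suc j) (λ ()) (λ _ ())
  matches (suc (suc i)) j = elsewhere (suc (suc i)) j (λ ()) (λ ())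

cospectral-K⇒switchingIsomorphic : ∀ k (Ψ : SignedDigraph (suc (suc k))) → Cospectral Ψ (K (suc (suc k))) →
  SwitchingIsomorphic (suc (suc k) , Ψ) (suc (suc k) , K (suc (suc k)))
cospectral-K⇒switchingIsomorphic k Ψ cospectral =
  balanced⇒switchingIsomorphic (suc k) Ψ complete (totalDefect≡0⇒balanced (gainsOf Ψ) total≡0)
  where
  n = suc (suc k)
  complete : Complete Ψ
  complete = cospectral⇒complete Ψ (K n) cospectral (K-complete n)
  total≡0 : totalDefect (gainsOf Ψ) ≡ 0
  total≡0 = trans (cospectral⇒totalDefect Ψ (K n) cospectral complete (K-complete n)) (K-totalDefect n)

cospectral-Kstar⇒switchingIsomorphic : ∀ k (Ψ : SignedDigraph (suc (suc k))) → Cospectral Ψ (Kstar k) →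
  SwitchingIsomorphic (suc (suc k) , Ψ) (suc (suc k) , Kstar k)
cospectral-Kstar⇒switchingIsomorphic k Ψ cospectral =
  kstarSwitchable⇒switchingIsomorphic k Ψ complete (totalDefect≡⇒kstarSwitchable k (gainsOf Ψ) total≡k)
  where
  complete : Complete Ψ
  complete = cospectral⇒complete Ψ (Kstar k) cospectral (Kstar-complete k)
  total≡k : totalDefect (gainsOf Ψ) ≡ k
  total≡k = trans (cospectral⇒totalDefect Ψ (Kstar k) cospectral complete (Kstar-complete k)) (Kstar-totalDefect k)

proposition6p9 : (k : ℕ) (Φ : SignedDigraph (suc (suc k))) →
    (Φ ≡ K (suc (suc k)) ⊎ Φ ≡ Kstar k) →
    (m : ℕ) (Ψ : SignedDigraph m) → Cospectral Ψ Φ →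
    SwitchingIsomorphic (m , Ψ) (suc (suc k) , Φ)
proposition6p9 k Φ isKorKstar m Ψ cospectral with cospectral⇒sameOrder Ψ Φ cospectral
proposition6p9 k Φ (inj₁ refl) m Ψ cospectral | refl = cospectral-K⇒switchingIsomorphic k Ψ cospectral
proposition6p9 k Φ (inj₂ refl) m Ψ cospectral | refl = cospectral-Kstar⇒switchingIsomorphic k Ψ cospectral
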